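{- Let $k\geqslant 0$ and $r\geqslant 1$ be integers. Then there exists a unique sequence of Laurent polynomials $\{P_{k,i}^{(r)}(q)\}_{i=k}^{rk}$ in $q$ with nonnegative integral coefficients such that, for every integer $n\geqslant k$, $$ {n\brack k}^r{n+k\brack k}^r=\sum_{i=k}^{\min\{n,rk\}} q^{(rk-i)n}{n\brack i}{n+i\brack i}P_{k,i}^{(r)}(q). $$ Moreover, these Laurent polynomials can be computed recursively by $P_{k,k}^{(1)}(q)=1$ and, for $0\leqslant j\leqslant rk$, $$ P_{k,k+j}^{(r+1)}(q)=\sum_{i=k}^{rk}q^{(j-i)(j+k)}{k+i\brack i}{k\brack i-j}{k+j\brack j}P_{k,i}^{(r)}(q). $$
   Context: For integers $n,k$, the $q$-binomial coefficient is ${n\brack k}=\frac{(q)_n}{(q)_k(q)_{n-k}}$ if $0\leqslant k\leqslant n$ and ${n\brack k}=0$ otherwise, where $(q)_0=1$ and $(q)_n=(1-q)(1-q^2)\cdots(1-q^n)$ for $n\geqslant 1$. -}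

module Defs where

open import Data.Nat as ℕ using (ℕ; zero; suc; _∸_)
open import Data.Integer as ℤ using (ℤ; +_; -[1+_])
open import Data.List using (List; []; _∷_; map; replicate; _++_)

-- Polynomials with nonnegative integer coefficients, as coefficient lists
-- (constant term first).
addL : List ℕ → List ℕ → List ℕ
addL [] ys = ys
addL (x ∷ xs) [] = x ∷ xs
addL (x ∷ xs) (y ∷ ys) = (x ℕ.+ y) ∷ addL xs ys

scaleL : ℕ → List ℕ → List ℕ
scaleL c = map (c ℕ.*_)

mulL : List ℕ → List ℕ → List ℕ
mulL [] ys = []
mulL (x ∷ xs) ys = addL (scaleL x ys) (0 ∷ mulL xs ys)

lookupD : List ℕ → ℕ → ℕ
lookupD [] _ = 0
lookupD (x ∷ xs) zero = x
lookupD (x ∷ xs) (suc m) = lookupD xs m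

-- Laurent polynomial  q^low * (c₀ + c₁ q + c₂ q² + …)  with cᵢ ∈ ℕ.
record LPoly : Set where
  constructor lp
  field
    low    : ℤ
    coeffs : List ℕ

coeff : LPoly → ℤ → ℕ
coeff (lp a xs) z with z ℤ.- a
... | + m = lookupD xs m
... | -[1+ _ ] = 0

infix 4 _≈_
_≈_ : LPoly → LPoly → Set
p ≈ p' = ∀ z → coeff p z ≡ coeff p' z
  where open import Relation.Binary.PropositionalEquality using (_≡_)

0L : LPoly
0L = lp (+ 0) []

mono : ℤ → LPoly
mono e = lp e (1 ∷ [])

1L : LPoly
1L = mono (+ 0)

infixl 6 _+L_
_+L_ : LPoly → LPoly → LPoly
lp a xs +L lp b ys =
  lp m (addL (replicate ℤ.∣ a ℤ.- m ∣ 0 ++ xs) (replicate ℤ.∣ b ℤ.- m ∣ 0 ++ ys))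
  where m = a ℤ.⊓ b

infixl 7 _*L_
_*L_ : LPoly → LPoly → LPoly
lp a xs *L lp b ys = lp (a ℤ.+ b) (mulL xs ys)

_^L_ : LPoly → ℕ → LPoly
p ^L zero = 1L
p ^L suc r = p *L (p ^L r)

sumN : ℕ → (ℕ → LPoly) → LPoly
sumN zero f = 0L
sumN (suc m) f = sumN m f +L f m

-- Σ_{i=a}^{b} f i   (empty if b < a)
sumFromTo : ℕ → ℕ → (ℕ → LPoly) → LPoly
sumFromTo a b f = sumN (suc b ∸ a) (λ t → f (a ℕ.+ t))

-- Gaussian polynomial [n brack k] for 0 ≤ k, n (zero if k > n),
-- computed by the q-Pascal rule [n brack k] = [n-1 brack k-1] + q^k [n-1 brack k].
qbL : ℕ → ℕ → List ℕ
qbL zero zero = 1 ∷ []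
qbL zero (suc k) = []
qbL (suc n) zero = 1 ∷ []
qbL (suc n) (suc k) = addL (qbL n k) (replicate (suc k) 0 ++ qbL n (suc k))

qbin : ℕ → ℕ → LPoly
qbin n k = lp (+ 0) (qbL n k)

qbinZ : ℤ → ℤ → LPoly
qbinZ (+ n) (+ k) = qbin n k
qbinZ (+ n) -[1+ _ ] = 0L
qbinZ -[1+ _ ] _ = 0L

-- Everything is evaluated at the integers q = b + 2: a Laurent polynomial with natural
-- coefficients is determined by these values, since for q larger than the sum of its
-- coefficients its value is a base-q numeral. Write B n m = [n,m][n+m,m]. At a fixed q the
-- expansion of (B n k)^(r+1) follows from that of (B n k)^r and the product formula
-- B n k * B n i = Σ_j q^((i-j)n) c k i j B n (k+j), which is proved by induction on i from
-- the ratio B n (i+1) / B n i and a three-term recurrence for the coefficients c; the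
-- recursion for P is exactly what this produces. Uniqueness holds because the identities for
-- n = k, k + 1, …, rk form a lower triangular system with nonzero diagonal.

module Submission where

open import Defs
open import Data.Nat as ℕ using (ℕ; zero; suc; _∸_; _≤_; _<_; _⊓_; z≤n; s≤s)
import Data.Nat.Properties as ℕₚ
open import Data.Integer as ℤ using (ℤ; +_; -[1+_]; _⊖_)
import Data.Integer.Properties as ℤₚ
open import Data.Integer.Tactic.RingSolver using (solve-∀)
open import Data.Rational as ℚ using (ℚ; mkℚ; 0ℚ; 1ℚ; 1/_)
import Data.Rational.Properties as ℚₚ
import Data.Rational.Unnormalised as ℚᵘ
import Data.Rational.Unnormalised.Properties as ℚᵘₚ
import Data.Nat.Coprimality as Coprime
open import Data.List using (List; []; _∷_; map; replicate; _++_; length)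
import Data.List.Properties as Listₚ
open import Data.Nat.ListAction using (sum)
open import Data.Sum using (inj₁; inj₂)
open import Data.Empty using (⊥-elim)
open import Relation.Binary.Definitions using (tri<; tri≈; tri>)
open import Relation.Binary.PropositionalEquality
open import Algebra.Properties.Group ℚₚ.+-0-group using (∙-cancelˡ; x∙y⁻¹≈ε⇒x≈y)
open ≡-Reasoning

module Rational where
  open import Data.Rational public using (_+_; _*_; _-_)
  open import Data.Rational.Solver using (module +-*-Solver)
  open +-*-Solver public using (solve; _:=_; con; _:+_; _:*_; _:-_)

  fromℕ : ℕ → ℚ
  fromℕ n = mkℚ (+ n) 0 (Coprime.sym (Coprime.1-coprimeTo n))

  fromℕ-injective : ∀ {m n} → fromℕ m ≡ fromℕ n → m ≡ n
  fromℕ-injective eq = ℤₚ.+-injective (cong ℚ.↥_ eq)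

  fromℕ-+ : ∀ m n → fromℕ (m ℕ.+ n) ≡ fromℕ m + fromℕ n
  fromℕ-+ m n = ℚₚ.toℚᵘ-injective (ℚᵘₚ.≃-sym (ℚᵘₚ.≃-trans (ℚₚ.toℚᵘ-homo-+ (fromℕ m) (fromℕ n)) (ℚᵘ.*≡* eq)))
    where
    eq : (+ m ℤ.* + 1 ℤ.+ + n ℤ.* + 1) ℤ.* + 1 ≡ + (m ℕ.+ n) ℤ.* (+ 1 ℤ.* + 1)
    eq = trans (normalise (+ m) (+ n)) (cong (ℤ._* (+ 1 ℤ.* + 1)) (sym (ℤₚ.pos-+ m n)))
      where
      normalise : ∀ x y → (x ℤ.* + 1 ℤ.+ y ℤ.* + 1) ℤ.* + 1 ≡ (x ℤ.+ y) ℤ.* (+ 1 ℤ.* + 1)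
      normalise = solve-∀

  fromℕ-* : ∀ m n → fromℕ (m ℕ.* n) ≡ fromℕ m * fromℕ n
  fromℕ-* m n = ℚₚ.toℚᵘ-injective (ℚᵘₚ.≃-sym (ℚᵘₚ.≃-trans (ℚₚ.toℚᵘ-homo-* (fromℕ m) (fromℕ n)) (ℚᵘ.*≡* eq)))
    where
    eq : (+ m ℤ.* + n) ℤ.* + 1 ≡ + (m ℕ.* n) ℤ.* (+ 1 ℤ.* + 1)
    eq = trans (normalise (+ m) (+ n)) (cong (ℤ._* (+ 1 ℤ.* + 1)) (sym (ℤₚ.pos-* m n)))
      where
      normalise : ∀ x y → (x ℤ.* y) ℤ.* + 1 ≡ (x ℤ.* y) ℤ.* (+ 1 ℤ.* + 1)
      normalise = solve-∀

  *-cancelʳ-≢0 : ∀ {x y z} → z ≢ 0ℚ → x * z ≡ y * z → x ≡ y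
  *-cancelʳ-≢0 {x} {y} {z} z≢0 eq = begin
    x                ≡⟨ regroup x ⟩
    x * z * z⁻¹      ≡⟨ cong (_* z⁻¹) eq ⟩
    y * z * z⁻¹      ≡⟨ sym (regroup y) ⟩
    y                ∎
    where
    instance _ = ℚ.≢-nonZero z≢0
    z⁻¹ = 1/ z
    regroup : ∀ w → w ≡ w * z * z⁻¹
    regroup w = sym (trans (ℚₚ.*-assoc w z z⁻¹)
                  (trans (cong (w *_) (ℚₚ.*-inverseʳ z)) (ℚₚ.*-identityʳ w)))

  *-cancelˡ-≢0 : ∀ {x y z} → z ≢ 0ℚ → z * x ≡ z * y → x ≡ y
  *-cancelˡ-≢0 {x} {y} {z} z≢0 eq =
    *-cancelʳ-≢0 z≢0 (trans (ℚₚ.*-comm x z) (trans eq (ℚₚ.*-comm z y)))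

  *-≢0 : ∀ {x y} → x ≢ 0ℚ → y ≢ 0ℚ → x * y ≢ 0ℚ
  *-≢0 {x} {y} x≢0 y≢0 xy≡0 = x≢0 (*-cancelʳ-≢0 y≢0 (trans xy≡0 (sym (ℚₚ.*-zeroˡ y))))

  ∑ : ℕ → (ℕ → ℚ) → ℚ
  ∑ zero    f = 0ℚ
  ∑ (suc m) f = ∑ m f + f m

  ∑-cong : ∀ m {f g : ℕ → ℚ} → (∀ j → j < m → f j ≡ g j) → ∑ m f ≡ ∑ m g
  ∑-cong zero    f≡g = refl
  ∑-cong (suc m) f≡g = cong₂ _+_ (∑-cong m (λ j j<m → f≡g j (ℕₚ.m<n⇒m<1+n j<m))) (f≡g m ℕₚ.≤-refl)

  ∑-zero : ∀ m (f : ℕ → ℚ) → (∀ j → j < m → f j ≡ 0ℚ) → ∑ m f ≡ 0ℚ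
  ∑-zero m f f≡0 = trans (∑-cong m f≡0) (zeros m)
    where
    zeros : ∀ m → ∑ m (λ _ → 0ℚ) ≡ 0ℚ
    zeros zero    = refl
    zeros (suc m) = cong (_+ 0ℚ) (zeros m)

  ∑-distrib-+ : ∀ m (f g : ℕ → ℚ) → ∑ m (λ j → f j + g j) ≡ ∑ m f + ∑ m g
  ∑-distrib-+ zero    f g = refl
  ∑-distrib-+ (suc m) f g = trans (cong (_+ (f m + g m)) (∑-distrib-+ m f g))
                                  (interchange (∑ m f) (∑ m g) (f m) (g m))
    where
    interchange : ∀ a b c d → (a + b) + (c + d) ≡ (a + c) + (b + d)
    interchange = solve 4 (λ a b c d → (a :+ b) :+ (c :+ d) := (a :+ c) :+ (b :+ d)) refl

  ∑-distribʳ-* : ∀ m (f : ℕ → ℚ) x → ∑ m f * x ≡ ∑ m (λ j → f j * x)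
  ∑-distribʳ-* zero    f x = ℚₚ.*-zeroˡ x
  ∑-distribʳ-* (suc m) f x =
    trans (ℚₚ.*-distribʳ-+ x (∑ m f) (f m)) (cong (_+ (f m * x)) (∑-distribʳ-* m f x))

  ∑-distribˡ-* : ∀ m (f : ℕ → ℚ) x → x * ∑ m f ≡ ∑ m (λ j → x * f j)
  ∑-distribˡ-* m f x = trans (ℚₚ.*-comm x (∑ m f))
    (trans (∑-distribʳ-* m f x) (∑-cong m (λ j _ → ℚₚ.*-comm (f j) x)))

  ∑-suc-head : ∀ m (f : ℕ → ℚ) → ∑ (suc m) f ≡ f 0 + ∑ m (λ j → f (suc j))
  ∑-suc-head zero    f = ℚₚ.+-comm 0ℚ (f 0)
  ∑-suc-head (suc m) f = trans (cong (_+ f (suc m)) (∑-suc-head m f))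
                               (ℚₚ.+-assoc (f 0) (∑ m (λ j → f (suc j))) (f (suc m)))

  ∑-zero-tail : ∀ m n (f : ℕ → ℚ) → m ≤ n → (∀ j → m ≤ j → j < n → f j ≡ 0ℚ) → ∑ n f ≡ ∑ m f
  ∑-zero-tail m zero    f z≤n tail≡0 = refl
  ∑-zero-tail m (suc n) f m≤1+n tail≡0 with ℕₚ.m≤n⇒m<n∨m≡n m≤1+n
  ... | inj₂ refl = refl
  ... | inj₁ (s≤s m≤n) = trans
    (cong₂ _+_ (∑-zero-tail m n f m≤n (λ j m≤j j<n → tail≡0 j m≤j (ℕₚ.m<n⇒m<1+n j<n)))
               (tail≡0 n m≤n ℕₚ.≤-refl))
    (ℚₚ.+-identityʳ (∑ m f))

  ∑-swap : ∀ m n (f : ℕ → ℕ → ℚ) → ∑ m (λ i → ∑ n (f i)) ≡ ∑ n (λ j → ∑ m (λ i → f i j))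
  ∑-swap zero    n f = sym (∑-zero n (λ _ → 0ℚ) (λ _ _ → refl))
  ∑-swap (suc m) n f = trans (cong (_+ ∑ n (f m)) (∑-swap m n f))
                             (sym (∑-distrib-+ n (λ j → ∑ m (λ i → f i j)) (f m)))

  lower-triangular-unique : ∀ N (X : ℕ → ℕ → ℚ) (f g : ℕ → ℚ) →
    (∀ w → w ≤ N → X w w ≢ 0ℚ) →
    (∀ w → w ≤ N → ∑ (suc w) (λ t → X w t * f t) ≡ ∑ (suc w) (λ t → X w t * g t)) →
    ∀ w → w ≤ N → f w ≡ g w
  lower-triangular-unique N X f g diag≢0 rows w w≤N = prefix w w≤N w ℕₚ.≤-refl
    where
    prefix : ∀ w → w ≤ N → ∀ t → t ≤ w → f t ≡ g t
    prefix zero w≤N .zero z≤n =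
      *-cancelˡ-≢0 (diag≢0 0 w≤N) (∙-cancelˡ 0ℚ _ _ (rows 0 w≤N))
    prefix (suc w) w≤N t t≤w with ℕₚ.m≤n⇒m<n∨m≡n t≤w
    ... | inj₁ (s≤s t≤w′) = prefix w (ℕₚ.≤-trans (ℕₚ.n≤1+n w) w≤N) t t≤w′
    ... | inj₂ refl = *-cancelˡ-≢0 (diag≢0 (suc w) w≤N) (∙-cancelˡ (∑ (suc w) (λ t → X (suc w) t * g t)) _ _ (begin
      ∑ (suc w) (λ t → X (suc w) t * g t) + X (suc w) (suc w) * f (suc w)
        ≡⟨ cong (_+ X (suc w) (suc w) * f (suc w)) (∑-cong (suc w) (λ t t<1+w →
             cong (X (suc w) t *_) (sym (prefix w (ℕₚ.≤-trans (ℕₚ.n≤1+n w) w≤N) t (ℕₚ.≤-pred t<1+w))))) ⟩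
      ∑ (suc w) (λ t → X (suc w) t * f t) + X (suc w) (suc w) * f (suc w)
        ≡⟨ rows (suc w) w≤N ⟩
      ∑ (suc w) (λ t → X (suc w) t * g t) + X (suc w) (suc w) * g (suc w) ∎))

module Digits (B : ℕ) where

  value : ℕ → (ℕ → ℕ) → ℕ
  value zero    d = 0
  value (suc N) d = value N d ℕ.+ d N ℕ.* B ℕ.^ N

  value< : ∀ N d → (∀ t → d t < B) → value N d < B ℕ.^ N
  value< zero    d d<B = s≤s z≤n
  value< (suc N) d d<B = ℕₚ.<-≤-trans (ℕₚ.+-monoˡ-< (d N ℕ.* B ℕ.^ N) (value< N d d<B))
                                       (ℕₚ.*-monoˡ-≤ (B ℕ.^ N) (d<B N))

  private
    leading< : ∀ a a' x x' M → a < M → x < x' → a ℕ.+ x ℕ.* M < a' ℕ.+ x' ℕ.* M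
    leading< a a' x x' M a<M x<x' = ℕₚ.<-≤-trans (ℕₚ.+-monoˡ-< (x ℕ.* M) a<M)
      (ℕₚ.≤-trans (ℕₚ.*-monoˡ-≤ M x<x') (ℕₚ.m≤n+m (x' ℕ.* M) a'))

    leading-unique : ∀ a a' x x' M → a < M → a' < M → a ℕ.+ x ℕ.* M ≡ a' ℕ.+ x' ℕ.* M → x ≡ x'
    leading-unique a a' x x' M a<M a'<M eq with ℕₚ.<-cmp x x'
    ... | tri< x<x' _ _ = ⊥-elim (ℕₚ.<-irrefl eq (leading< a a' x x' M a<M x<x'))
    ... | tri≈ _ x≡x' _ = x≡x'
    ... | tri> _ _ x>x' = ⊥-elim (ℕₚ.<-irrefl (sym eq) (leading< a' a x' x M a'<M x>x'))

  digits-unique : ∀ N (d d′ : ℕ → ℕ) → (∀ t → d t < B) → (∀ t → d′ t < B) →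
    value N d ≡ value N d′ → ∀ t → t < N → d t ≡ d′ t
  digits-unique (suc N) d d′ d<B d′<B eq t t<1+N with ℕₚ.m≤n⇒m<n∨m≡n (ℕₚ.≤-pred t<1+N)
  ... | inj₁ t<N  = digits-unique N d d′ d<B d′<B lower t t<N
    where
    lower : value N d ≡ value N d′
    lower = ℕₚ.+-cancelʳ-≡ (d N ℕ.* B ℕ.^ N) _ _ (trans eq (cong (λ x → value N d′ ℕ.+ x ℕ.* B ℕ.^ N)
      (sym (leading-unique _ _ (d N) (d′ N) (B ℕ.^ N) (value< N d d<B) (value< N d′ d′<B) eq))))
  ... | inj₂ refl = leading-unique _ _ (d N) (d′ N) (B ℕ.^ N) (value< N d d<B) (value< N d′ d′<B) eq

module Powers (b : ℕ) where
  open Rational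

  base : ℕ
  base = suc (suc b)

  q : ℚ
  q = fromℕ base

  infix 9 q^_ q⁻^_ q^ℤ_

  q^_ : ℕ → ℚ
  q^ zero  = 1ℚ
  q^ suc m = q * q^ m

  q^-fromℕ : ∀ m → q^ m ≡ fromℕ (base ℕ.^ m)
  q^-fromℕ zero    = refl
  q^-fromℕ (suc m) = trans (cong (q *_) (q^-fromℕ m)) (sym (fromℕ-* base (base ℕ.^ m)))

  q^-+ : ∀ m n → q^ (m ℕ.+ n) ≡ q^ m * q^ n
  q^-+ zero    n = sym (ℚₚ.*-identityˡ (q^ n))
  q^-+ (suc m) n = trans (cong (q *_) (q^-+ m n)) (sym (ℚₚ.*-assoc q (q^ m) (q^ n)))

  base^>0 : ∀ m → 0 < base ℕ.^ m
  base^>0 zero    = s≤s z≤n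
  base^>0 (suc m) = ℕₚ.*-mono-≤ {1} {base} (s≤s z≤n) (base^>0 m)

  q^≢0 : ∀ m → q^ m ≢ 0ℚ
  q^≢0 m q^m≡0 = ℕₚ.<⇒≢ (base^>0 m) (sym (fromℕ-injective (trans (sym (q^-fromℕ m)) q^m≡0)))

  1-q^suc≢0 : ∀ m → 1ℚ - q^ suc m ≢ 0ℚ
  1-q^suc≢0 m 1-q^≡0 = ℕₚ.<⇒≢ base^suc>1 (fromℕ-injective (trans (x∙y⁻¹≈ε⇒x≈y _ _ 1-q^≡0) (q^-fromℕ (suc m))))
    where
    base^suc>1 : 1 < base ℕ.^ suc m
    base^suc>1 = ℕₚ.*-mono-≤ {2} {base} (s≤s (s≤s z≤n)) (base^>0 m)

  q≢0 : q ≢ 0ℚ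
  q≢0 q≡0 = ℕₚ.1+n≢0 (fromℕ-injective q≡0)

  private instance
    q-nonZero : ℚ.NonZero q
    q-nonZero = ℚ.≢-nonZero q≢0

  q⁻¹ : ℚ
  q⁻¹ = 1/ q

  q*q⁻¹ : q * q⁻¹ ≡ 1ℚ
  q*q⁻¹ = ℚₚ.*-inverseʳ q

  q⁻^_ : ℕ → ℚ
  q⁻^ zero  = 1ℚ
  q⁻^ suc m = q⁻¹ * q⁻^ m

  q⁻^-+ : ∀ m n → q⁻^ (m ℕ.+ n) ≡ q⁻^ m * q⁻^ n
  q⁻^-+ zero    n = sym (ℚₚ.*-identityˡ (q⁻^ n))
  q⁻^-+ (suc m) n = trans (cong (q⁻¹ *_) (q⁻^-+ m n)) (sym (ℚₚ.*-assoc q⁻¹ (q⁻^ m) (q⁻^ n)))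

  private
    interchange : ∀ (a b c d : ℚ) → (a * b) * (c * d) ≡ (a * c) * (b * d)
    interchange = solve 4 (λ a b c d → (a :* b) :* (c :* d) := (a :* c) :* (b :* d)) refl

  q^*q⁻^ : ∀ m → q^ m * q⁻^ m ≡ 1ℚ
  q^*q⁻^ zero    = refl
  q^*q⁻^ (suc m) = begin
    (q * q^ m) * (q⁻¹ * q⁻^ m)  ≡⟨ interchange q (q^ m) q⁻¹ (q⁻^ m) ⟩
    (q * q⁻¹) * (q^ m * q⁻^ m)  ≡⟨ cong₂ _*_ q*q⁻¹ (q^*q⁻^ m) ⟩
    1ℚ                          ∎

  q^ℤ_ : ℤ → ℚ
  q^ℤ (+ m)    = q^ m
  q^ℤ -[1+ m ] = q⁻^ suc m

  q^ℤ-⊖ : ∀ m n → q^ℤ (m ⊖ n) ≡ q^ m * q⁻^ n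
  q^ℤ-⊖ m       zero    = trans (cong q^ℤ_ (ℤₚ.⊖-≥ {m} {0} z≤n)) (sym (ℚₚ.*-identityʳ (q^ m)))
  q^ℤ-⊖ zero    (suc n) = sym (ℚₚ.*-identityˡ (q⁻^ suc n))
  q^ℤ-⊖ (suc m) (suc n) = begin
    q^ℤ (suc m ⊖ suc n)            ≡⟨ cong q^ℤ_ (ℤₚ.[1+m]⊖[1+n]≡m⊖n m n) ⟩
    q^ℤ (m ⊖ n)                    ≡⟨ q^ℤ-⊖ m n ⟩
    q^ m * q⁻^ n                   ≡⟨ sym (ℚₚ.*-identityˡ _) ⟩
    1ℚ * (q^ m * q⁻^ n)            ≡⟨ cong (_* (q^ m * q⁻^ n)) (sym q*q⁻¹) ⟩
    (q * q⁻¹) * (q^ m * q⁻^ n)     ≡⟨ interchange q q⁻¹ (q^ m) (q⁻^ n) ⟩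
    (q * q^ m) * (q⁻¹ * q⁻^ n)     ∎

  q^ℤ-+ : ∀ x y → q^ℤ (x ℤ.+ y) ≡ q^ℤ x * q^ℤ y
  q^ℤ-+ (+ m)    (+ n)    = q^-+ m n
  q^ℤ-+ (+ m)    -[1+ n ] = q^ℤ-⊖ m (suc n)
  q^ℤ-+ -[1+ m ] (+ n)    = trans (q^ℤ-⊖ n (suc m)) (ℚₚ.*-comm (q^ n) (q⁻^ suc m))
  q^ℤ-+ -[1+ m ] -[1+ n ] = begin
    q⁻¹ * (q⁻¹ * q⁻^ (m ℕ.+ n))        ≡⟨ cong (λ t → q⁻¹ * (q⁻¹ * t)) (q⁻^-+ m n) ⟩
    q⁻¹ * (q⁻¹ * (q⁻^ m * q⁻^ n))      ≡⟨ regroup q⁻¹ (q⁻^ m) (q⁻^ n) ⟩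
    (q⁻¹ * q⁻^ m) * (q⁻¹ * q⁻^ n)      ∎
    where
    regroup : ∀ a x y → a * (a * (x * y)) ≡ (a * x) * (a * y)
    regroup = solve 3 (λ a x y → a :* (a :* (x :* y)) := (a :* x) :* (a :* y)) refl

  q⁻^≢0 : ∀ m → q⁻^ m ≢ 0ℚ
  q⁻^≢0 m q⁻^m≡0 = ℚₚ.1≢0 (begin
    1ℚ               ≡⟨ sym (q^*q⁻^ m) ⟩
    q^ m * q⁻^ m     ≡⟨ cong (q^ m *_) q⁻^m≡0 ⟩
    q^ m * 0ℚ        ≡⟨ ℚₚ.*-zeroʳ (q^ m) ⟩
    0ℚ               ∎)

  q^ℤ≢0 : ∀ x → q^ℤ x ≢ 0ℚ
  q^ℤ≢0 (+ m)    = q^≢0 m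
  q^ℤ≢0 -[1+ m ] = q⁻^≢0 (suc m)

  sumℤ : List ℤ → ℤ
  sumℤ []           = + 0
  sumℤ (x ∷ [])     = x
  sumℤ (x ∷ y ∷ es) = x ℤ.+ sumℤ (y ∷ es)

  prodℚ : List ℚ → ℚ
  prodℚ []           = 1ℚ
  prodℚ (x ∷ [])     = x
  prodℚ (x ∷ y ∷ xs) = x * prodℚ (y ∷ xs)

  -- Identities between Laurent monomials are reduced to identities between their exponents,
  -- which the integer ring solver proves.
  q^ℤ-sum : ∀ {e} (es : List ℤ) → e ≡ sumℤ es → q^ℤ e ≡ prodℚ (map q^ℤ_ es)
  q^ℤ-sum []           refl = refl
  q^ℤ-sum (x ∷ [])     refl = refl
  q^ℤ-sum (x ∷ y ∷ es) refl = trans (q^ℤ-+ x (sumℤ (y ∷ es))) (cong (q^ℤ x *_) (q^ℤ-sum (y ∷ es) refl))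

module Binomials (b : ℕ) where
  open Rational
  open Powers b

  qbinom : ℕ → ℕ → ℚ
  qbinom zero    zero    = 1ℚ
  qbinom zero    (suc k) = 0ℚ
  qbinom (suc n) zero    = 1ℚ
  qbinom (suc n) (suc k) = qbinom n k + q^ suc k * qbinom n (suc k)

  qbinomℤ : ℤ → ℤ → ℚ
  qbinomℤ (+ n)    (+ k)    = qbinom n k
  qbinomℤ (+ n)    -[1+ _ ] = 0ℚ
  qbinomℤ -[1+ _ ] _        = 0ℚ

  qfall : ℕ → ℕ → ℚ
  qfall zero    zero    = 1ℚ
  qfall zero    (suc m) = 0ℚ
  qfall (suc n) zero    = 1ℚ
  qfall (suc n) (suc m) = (1ℚ - q^ suc n) * qfall n m

  qfac : ℕ → ℚ
  qfac m = qfall m m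

  qbinom-zeroʳ : ∀ n → qbinom n 0 ≡ 1ℚ
  qbinom-zeroʳ zero    = refl
  qbinom-zeroʳ (suc n) = refl

  qfall-step : ∀ n m → q^ m * qfall n (suc m) ≡ qfall n m * (q^ m - q^ n)
  qfall-step zero    zero    = refl
  qfall-step zero    (suc m) = trans (ℚₚ.*-zeroʳ (q^ suc m)) (sym (ℚₚ.*-zeroˡ (q^ suc m - 1ℚ)))
  qfall-step (suc n) zero    =
    cong (1ℚ *_) (trans (cong ((1ℚ - q^ suc n) *_) (qfall-zeroʳ n)) (ℚₚ.*-identityʳ (1ℚ - q^ suc n)))
    where
    qfall-zeroʳ : ∀ n → qfall n 0 ≡ 1ℚ
    qfall-zeroʳ zero    = refl
    qfall-zeroʳ (suc n) = refl
  qfall-step (suc n) (suc m) = begin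
    (q * q^ m) * ((1ℚ - q * q^ n) * qfall n (suc m))   ≡⟨ regroup₁ q (q^ m) (q^ n) (qfall n (suc m)) ⟩
    q * (1ℚ - q * q^ n) * (q^ m * qfall n (suc m))     ≡⟨ cong (q * (1ℚ - q * q^ n) *_) (qfall-step n m) ⟩
    q * (1ℚ - q * q^ n) * (qfall n m * (q^ m - q^ n))  ≡⟨ regroup₂ q (q^ m) (q^ n) (qfall n m) ⟩
    ((1ℚ - q * q^ n) * qfall n m) * (q * q^ m - q * q^ n) ∎
    where
    regroup₁ : ∀ a x y f → (a * x) * ((1ℚ - a * y) * f) ≡ a * (1ℚ - a * y) * (x * f)
    regroup₁ = solve 4 (λ a x y f → (a :* x) :* ((con 1ℚ :- a :* y) :* f)
                                 := a :* (con 1ℚ :- a :* y) :* (x :* f)) refl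
    regroup₂ : ∀ a x y f → a * (1ℚ - a * y) * (f * (x - y)) ≡ ((1ℚ - a * y) * f) * (a * x - a * y)
    regroup₂ = solve 4 (λ a x y f → a :* (con 1ℚ :- a :* y) :* (f :* (x :- y))
                                 := ((con 1ℚ :- a :* y) :* f) :* (a :* x :- a :* y)) refl

  qbinom-*-qfac : ∀ n m → qbinom n m * qfac m ≡ qfall n m
  qbinom-*-qfac zero    zero    = refl
  qbinom-*-qfac zero    (suc m) = ℚₚ.*-zeroˡ (qfac (suc m))
  qbinom-*-qfac (suc n) zero    = refl
  qbinom-*-qfac (suc n) (suc m) = begin
    (qbinom n m + q^ suc m * qbinom n (suc m)) * ((1ℚ - q^ suc m) * qfac m)
      ≡⟨ expand (qbinom n m) (q^ suc m) (qbinom n (suc m)) (qfac m) ⟩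
    (qbinom n m * qfac m) * (1ℚ - q^ suc m) + q^ suc m * (qbinom n (suc m) * ((1ℚ - q^ suc m) * qfac m))
      ≡⟨ cong₂ (λ x y → x * (1ℚ - q^ suc m) + q^ suc m * y) (qbinom-*-qfac n m) (qbinom-*-qfac n (suc m)) ⟩
    qfall n m * (1ℚ - q * q^ m) + (q * q^ m) * qfall n (suc m)
      ≡⟨ cong (_+_ (qfall n m * (1ℚ - q * q^ m)))
           (trans (ℚₚ.*-assoc q (q^ m) _) (cong (q *_) (qfall-step n m))) ⟩
    qfall n m * (1ℚ - q * q^ m) + q * (qfall n m * (q^ m - q^ n))
      ≡⟨ collect (qfall n m) q (q^ m) (q^ n) ⟩
    (1ℚ - q * q^ n) * qfall n m ∎
    where
    expand : ∀ a x c p → (a + x * c) * ((1ℚ - x) * p) ≡ (a * p) * (1ℚ - x) + x * (c * ((1ℚ - x) * p))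
    expand = solve 4 (λ a x c p → (a :+ x :* c) :* ((con 1ℚ :- x) :* p)
                               := (a :* p) :* (con 1ℚ :- x) :+ x :* (c :* ((con 1ℚ :- x) :* p))) refl
    collect : ∀ f a x y → f * (1ℚ - a * x) + a * (f * (x - y)) ≡ (1ℚ - a * y) * f
    collect = solve 4 (λ f a x y → f :* (con 1ℚ :- a :* x) :+ a :* (f :* (x :- y))
                                := (con 1ℚ :- a :* y) :* f) refl

  qfall≢0 : ∀ n m → m ≤ n → qfall n m ≢ 0ℚ
  qfall≢0 zero    zero    _         ()
  qfall≢0 (suc n) zero    _         ()
  qfall≢0 (suc n) (suc m) (s≤s m≤n) = *-≢0 (1-q^suc≢0 n) (qfall≢0 n m m≤n)

  qbinom≢0 : ∀ n m → m ≤ n → qbinom n m ≢ 0ℚ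
  qbinom≢0 n m m≤n qbinom≡0 = qfall≢0 n m m≤n
    (trans (sym (qbinom-*-qfac n m)) (trans (cong (_* qfac m) qbinom≡0) (ℚₚ.*-zeroˡ (qfac m))))

  qbinom-> : ∀ n m → n < m → qbinom n m ≡ 0ℚ
  qbinom-> zero    (suc m) _         = refl
  qbinom-> (suc n) (suc m) (s≤s n<m) = begin
    qbinom n m + q^ suc m * qbinom n (suc m)
      ≡⟨ cong₂ (λ x y → x + q^ suc m * y) (qbinom-> n m n<m) (qbinom-> n (suc m) (ℕₚ.m<n⇒m<1+n n<m)) ⟩
    0ℚ + q^ suc m * 0ℚ   ≡⟨ cong (_+_ 0ℚ) (ℚₚ.*-zeroʳ (q^ suc m)) ⟩
    0ℚ                   ∎

  qbinom-absorb : ∀ a c → qbinom (suc a) (suc c) * (1ℚ - q^ suc c) ≡ (1ℚ - q^ suc a) * qbinom a c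
  qbinom-absorb a c = *-cancelʳ-≢0 (qfall≢0 c c ℕₚ.≤-refl) (begin
    qbinom (suc a) (suc c) * (1ℚ - q^ suc c) * qfac c  ≡⟨ ℚₚ.*-assoc (qbinom (suc a) (suc c)) (1ℚ - q^ suc c) (qfac c) ⟩
    qbinom (suc a) (suc c) * qfac (suc c)              ≡⟨ qbinom-*-qfac (suc a) (suc c) ⟩
    (1ℚ - q^ suc a) * qfall a c                        ≡⟨ cong ((1ℚ - q^ suc a) *_) (sym (qbinom-*-qfac a c)) ⟩
    (1ℚ - q^ suc a) * (qbinom a c * qfac c)            ≡⟨ sym (ℚₚ.*-assoc (1ℚ - q^ suc a) (qbinom a c) (qfac c)) ⟩
    (1ℚ - q^ suc a) * qbinom a c * qfac c              ∎)

  qbinom-sucʳ : ∀ a c → q^ c * (qbinom a (suc c) * (1ℚ - q^ suc c)) ≡ qbinom a c * (q^ c - q^ a)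
  qbinom-sucʳ a c = *-cancelʳ-≢0 (qfall≢0 c c ℕₚ.≤-refl) (begin
    q^ c * (qbinom a (suc c) * (1ℚ - q^ suc c)) * qfac c  ≡⟨ regroup₁ (q^ c) (qbinom a (suc c)) (1ℚ - q^ suc c) (qfac c) ⟩
    q^ c * (qbinom a (suc c) * qfac (suc c))              ≡⟨ cong (q^ c *_) (qbinom-*-qfac a (suc c)) ⟩
    q^ c * qfall a (suc c)                                ≡⟨ qfall-step a c ⟩
    qfall a c * (q^ c - q^ a)                             ≡⟨ cong (_* (q^ c - q^ a)) (sym (qbinom-*-qfac a c)) ⟩
    qbinom a c * qfac c * (q^ c - q^ a)                   ≡⟨ regroup₂ (qbinom a c) (qfac c) (q^ c - q^ a) ⟩
    qbinom a c * (q^ c - q^ a) * qfac c                   ∎)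
    where
    regroup₁ : ∀ x y z w → x * (y * z) * w ≡ x * (y * (z * w))
    regroup₁ = solve 4 (λ x y z w → x :* (y :* z) :* w := x :* (y :* (z :* w))) refl
    regroup₂ : ∀ x y z → x * y * z ≡ x * z * y
    regroup₂ = solve 3 (λ x y z → x :* y :* z := x :* z :* y) refl

  qbinomℤ-≥ : ∀ k i j → j ≤ i → qbinomℤ (+ k) (+ i ℤ.- + j) ≡ qbinom k (i ∸ j)
  qbinomℤ-≥ k i j j≤i = cong (qbinomℤ (+ k)) (trans (ℤₚ.m-n≡m⊖n i j) (ℤₚ.⊖-≥ j≤i))

  qbinomℤ-< : ∀ k i j → i < j → qbinomℤ (+ k) (+ i ℤ.- + j) ≡ 0ℚ
  qbinomℤ-< k i (suc j) (s≤s i≤j) =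
    cong (qbinomℤ (+ k)) (trans (ℤₚ.m-n≡m⊖n i (suc j)) (trans (ℤₚ.⊖-≤ (ℕₚ.m≤n⇒m≤1+n i≤j)) (cong (λ d → ℤ.- (+ d)) (ℕₚ.+-∸-assoc 1 i≤j))))

module Linearisation (b : ℕ) where
  open Rational
  open Powers b
  open Binomials b

  -- The recurrence c-step below for i = s + j + 1, after clearing the nonzero denominators
  -- (1 - q^(s+1)) (1 - q^(j+1)). The variables stand for Q = q, A = q^j, K = q^k, S = q^s, and
  -- every Laurent monomial occurring in c and h is written as a common monomial U times a monomial.
  c-step-algebra : ∀ {Q A K S U b₁ b₂ b₃ b₄ z₁ z₃ x₁ x₂ x₄ x₅ x₆ p₁ p₂ p₃ H Z₁ Z₂ Z₃} →
    x₁ ≡ Q * (Q * (S * A)) → x₂ ≡ Q * (K * A) → x₄ ≡ Q * (K * (Q * (S * A))) →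
    x₅ ≡ Q * A → x₆ ≡ Q * S →
    p₁ ≡ U * S → p₂ ≡ U * (Q * (S * S)) → p₃ ≡ U * (S * (Q * (A * K))) →
    H * p₃ ≡ (U * S + U * (S * (Q * (Q * (Q * (A * (A * (K * K))))))))
           - (U * K + U * (S * (S * (Q * (Q * (Q * (A * (A * K)))))))) →
    (1ℚ - x₆) * (1ℚ - x₅) ≢ 0ℚ →
    b₁ * (1ℚ - x₁) ≡ (1ℚ - x₄) * b₃ →
    b₂ * (1ℚ - x₅) ≡ (1ℚ - x₂) * b₄ →
    S * (z₁ * (1ℚ - x₆)) ≡ z₃ * (S - K) →
    Z₁ ≡ z₁ → Z₂ ≡ z₁ → Z₃ ≡ z₃ →
    (1ℚ - x₁) * (1ℚ - x₁) * (p₁ * b₁ * Z₁ * b₂)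
      ≡ (1ℚ - x₂) * (1ℚ - x₂) * (p₂ * b₃ * Z₂ * b₄) + H * (p₃ * b₃ * Z₃ * b₂)
  c-step-algebra {Q} {A} {K} {S} {U} {b₁} {b₂} {b₃} {b₄} {z₁} {z₃} {H = H}
    refl refl refl refl refl refl refl refl hp₃ nz e₁ e₂ e₃ refl refl refl = *-cancelʳ-≢0 nz (begin
      (1ℚ - x₁) * (1ℚ - x₁) * (U * S * b₁ * z₁ * b₂) * D
        ≡⟨ regroupˡ x₁ U S b₁ z₁ b₂ x₆ x₅ ⟩
      (1ℚ - x₁) * U * (b₁ * (1ℚ - x₁)) * (S * (z₁ * (1ℚ - x₆))) * (b₂ * (1ℚ - x₅))
        ≡⟨ cong₂ (λ u v → (1ℚ - x₁) * U * u * v * (b₂ * (1ℚ - x₅))) e₁ e₃ ⟩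
      (1ℚ - x₁) * U * ((1ℚ - x₄) * b₃) * (z₃ * (S - K)) * (b₂ * (1ℚ - x₅))
        ≡⟨ cong ((1ℚ - x₁) * U * ((1ℚ - x₄) * b₃) * (z₃ * (S - K)) *_) e₂ ⟩
      (1ℚ - x₁) * U * ((1ℚ - x₄) * b₃) * (z₃ * (S - K)) * ((1ℚ - x₂) * b₄)
        ≡⟨ identity Q A K S U b₃ z₃ b₄ ⟩
      (1ℚ - x₂) * (1ℚ - x₂) * (U * (Q * S)) * b₃ * b₄ * (1ℚ - x₅) * (z₃ * (S - K))
        + M * b₃ * z₃ * (1ℚ - x₆) * ((1ℚ - x₂) * b₄)
        ≡⟨ sym (cong₂ (λ u v → (1ℚ - x₂) * (1ℚ - x₂) * (U * (Q * S)) * b₃ * b₄ * (1ℚ - x₅) * u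
                                 + M * b₃ * z₃ * (1ℚ - x₆) * v) e₃ e₂) ⟩
      (1ℚ - x₂) * (1ℚ - x₂) * (U * (Q * S)) * b₃ * b₄ * (1ℚ - x₅) * (S * (z₁ * (1ℚ - x₆)))
        + M * b₃ * z₃ * (1ℚ - x₆) * (b₂ * (1ℚ - x₅))
        ≡⟨ cong (λ m → (1ℚ - x₂) * (1ℚ - x₂) * (U * (Q * S)) * b₃ * b₄ * (1ℚ - x₅) * (S * (z₁ * (1ℚ - x₆)))
                         + m * b₃ * z₃ * (1ℚ - x₆) * (b₂ * (1ℚ - x₅))) (sym hp₃) ⟩
      (1ℚ - x₂) * (1ℚ - x₂) * (U * (Q * S)) * b₃ * b₄ * (1ℚ - x₅) * (S * (z₁ * (1ℚ - x₆)))
        + H * p₃ * b₃ * z₃ * (1ℚ - x₆) * (b₂ * (1ℚ - x₅))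
        ≡⟨ regroupʳ x₂ U Q S b₃ z₁ b₄ H p₃ z₃ b₂ x₅ x₆ ⟩
      ((1ℚ - x₂) * (1ℚ - x₂) * (U * (Q * (S * S)) * b₃ * z₁ * b₄) + H * (p₃ * b₃ * z₃ * b₂)) * D ∎)
    where
    x₁ = Q * (Q * (S * A))
    x₂ = Q * (K * A)
    x₄ = Q * (K * (Q * (S * A)))
    x₅ = Q * A
    x₆ = Q * S
    p₃ = U * (S * (Q * (A * K)))
    D = (1ℚ - x₆) * (1ℚ - x₅)
    M = (U * S + U * (S * (Q * (Q * (Q * (A * (A * (K * K))))))))
      - (U * K + U * (S * (S * (Q * (Q * (Q * (A * (A * K))))))))
    regroupˡ : ∀ x U S b₁ z₁ b₂ x₆ x₅ →
      (1ℚ - x) * (1ℚ - x) * (U * S * b₁ * z₁ * b₂) * ((1ℚ - x₆) * (1ℚ - x₅))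
        ≡ (1ℚ - x) * U * (b₁ * (1ℚ - x)) * (S * (z₁ * (1ℚ - x₆))) * (b₂ * (1ℚ - x₅))
    regroupˡ = solve 8 (λ x U S b₁ z₁ b₂ x₆ x₅ →
      (con 1ℚ :- x) :* (con 1ℚ :- x) :* (U :* S :* b₁ :* z₁ :* b₂) :* ((con 1ℚ :- x₆) :* (con 1ℚ :- x₅))
        := (con 1ℚ :- x) :* U :* (b₁ :* (con 1ℚ :- x)) :* (S :* (z₁ :* (con 1ℚ :- x₆))) :* (b₂ :* (con 1ℚ :- x₅))) refl
    regroupʳ : ∀ x₂ U Q S b₃ z₁ b₄ H p₃ z₃ b₂ x₅ x₆ →
      (1ℚ - x₂) * (1ℚ - x₂) * (U * (Q * S)) * b₃ * b₄ * (1ℚ - x₅) * (S * (z₁ * (1ℚ - x₆)))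
        + H * p₃ * b₃ * z₃ * (1ℚ - x₆) * (b₂ * (1ℚ - x₅))
      ≡ ((1ℚ - x₂) * (1ℚ - x₂) * (U * (Q * (S * S)) * b₃ * z₁ * b₄) + H * (p₃ * b₃ * z₃ * b₂))
        * ((1ℚ - x₆) * (1ℚ - x₅))
    regroupʳ = solve 13 (λ x₂ U Q S b₃ z₁ b₄ H p₃ z₃ b₂ x₅ x₆ →
      (con 1ℚ :- x₂) :* (con 1ℚ :- x₂) :* (U :* (Q :* S)) :* b₃ :* b₄ :* (con 1ℚ :- x₅) :* (S :* (z₁ :* (con 1ℚ :- x₆)))
        :+ H :* p₃ :* b₃ :* z₃ :* (con 1ℚ :- x₆) :* (b₂ :* (con 1ℚ :- x₅))
      := ((con 1ℚ :- x₂) :* (con 1ℚ :- x₂) :* (U :* (Q :* (S :* S)) :* b₃ :* z₁ :* b₄) :+ H :* (p₃ :* b₃ :* z₃ :* b₂))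
        :* ((con 1ℚ :- x₆) :* (con 1ℚ :- x₅))) refl
    identity : ∀ Q A K S U b₃ z₃ b₄ →
      let x₁ = Q * (Q * (S * A)); x₂ = Q * (K * A); x₄ = Q * (K * (Q * (S * A))); x₅ = Q * A; x₆ = Q * S in
      (1ℚ - x₁) * U * ((1ℚ - x₄) * b₃) * (z₃ * (S - K)) * ((1ℚ - x₂) * b₄)
        ≡ (1ℚ - x₂) * (1ℚ - x₂) * (U * (Q * S)) * b₃ * b₄ * (1ℚ - x₅) * (z₃ * (S - K))
          + ((U * S + U * (S * (Q * (Q * (Q * (A * (A * (K * K))))))))
              - (U * K + U * (S * (S * (Q * (Q * (Q * (A * (A * K))))))))) * b₃ * z₃ * (1ℚ - x₆) * ((1ℚ - x₂) * b₄)
    identity = solve 8 (λ Q A K S U b₃ z₃ b₄ →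
      (con 1ℚ :- Q :* (Q :* (S :* A))) :* U :* ((con 1ℚ :- Q :* (K :* (Q :* (S :* A)))) :* b₃)
        :* (z₃ :* (S :- K)) :* ((con 1ℚ :- Q :* (K :* A)) :* b₄)
      := (con 1ℚ :- Q :* (K :* A)) :* (con 1ℚ :- Q :* (K :* A)) :* (U :* (Q :* S)) :* b₃ :* b₄
           :* (con 1ℚ :- Q :* A) :* (z₃ :* (S :- K))
         :+ ((U :* S :+ U :* (S :* (Q :* (Q :* (Q :* (A :* (A :* (K :* K))))))))
              :- (U :* K :+ U :* (S :* (S :* (Q :* (Q :* (Q :* (A :* (A :* K))))))))) :* b₃ :* z₃
           :* (con 1ℚ :- Q :* S) :* ((con 1ℚ :- Q :* (K :* A)) :* b₄)) refl

  -- The same for j = 0, with V = q^i and K = q^k.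
  c-step-zero-algebra : ∀ {Q V K U b₀ b₁ b₃ z₁ z₂ x x′ p₁ p₂ H Z₁ Z₂} →
    x ≡ Q * V → x′ ≡ Q * (K * V) → p₁ ≡ U * V → p₂ ≡ U * (V * K) →
    H * p₂ ≡ (U * V + U * (V * (K * (K * Q)))) - (U * K + U * (V * (V * (K * Q)))) →
    b₁ * (1ℚ - x) ≡ (1ℚ - x′) * b₃ →
    V * (z₁ * (1ℚ - x)) ≡ z₂ * (V - K) →
    Z₁ ≡ z₁ → Z₂ ≡ z₂ →
    (1ℚ - x) * (1ℚ - x) * (p₁ * b₁ * Z₁ * b₀) ≡ H * (p₂ * b₃ * Z₂ * b₀)
  c-step-zero-algebra {Q} {V} {K} {U} {b₀} {b₁} {b₃} {z₁} {z₂} {H = H} refl refl refl refl hp₂ e₁ e₂ refl refl = begin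
    (1ℚ - Q * V) * (1ℚ - Q * V) * (U * V * b₁ * z₁ * b₀)
      ≡⟨ regroupˡ (Q * V) U V b₁ z₁ b₀ ⟩
    U * b₀ * (b₁ * (1ℚ - Q * V)) * (V * (z₁ * (1ℚ - Q * V)))
      ≡⟨ cong₂ (λ u v → U * b₀ * u * v) e₁ e₂ ⟩
    U * b₀ * ((1ℚ - Q * (K * V)) * b₃) * (z₂ * (V - K))
      ≡⟨ identity Q V K U b₀ b₃ z₂ ⟩
    ((U * V + U * (V * (K * (K * Q)))) - (U * K + U * (V * (V * (K * Q))))) * (b₃ * z₂ * b₀)
      ≡⟨ cong (_* (b₃ * z₂ * b₀)) (sym hp₂) ⟩
    H * (U * (V * K)) * (b₃ * z₂ * b₀)
      ≡⟨ regroupʳ H (U * (V * K)) b₃ z₂ b₀ ⟩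
    H * (U * (V * K) * b₃ * z₂ * b₀) ∎
    where
    regroupˡ : ∀ x U V b₁ z₁ b₀ →
      (1ℚ - x) * (1ℚ - x) * (U * V * b₁ * z₁ * b₀) ≡ U * b₀ * (b₁ * (1ℚ - x)) * (V * (z₁ * (1ℚ - x)))
    regroupˡ = solve 6 (λ x U V b₁ z₁ b₀ → (con 1ℚ :- x) :* (con 1ℚ :- x) :* (U :* V :* b₁ :* z₁ :* b₀)
      := U :* b₀ :* (b₁ :* (con 1ℚ :- x)) :* (V :* (z₁ :* (con 1ℚ :- x)))) refl
    identity : ∀ Q V K U b₀ b₃ z₂ →
      U * b₀ * ((1ℚ - Q * (K * V)) * b₃) * (z₂ * (V - K))
        ≡ ((U * V + U * (V * (K * (K * Q)))) - (U * K + U * (V * (V * (K * Q))))) * (b₃ * z₂ * b₀)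
    identity = solve 7 (λ Q V K U b₀ b₃ z₂ → U :* b₀ :* ((con 1ℚ :- Q :* (K :* V)) :* b₃) :* (z₂ :* (V :- K))
      := ((U :* V :+ U :* (V :* (K :* (K :* Q)))) :- (U :* K :+ U :* (V :* (V :* (K :* Q))))) :* (b₃ :* z₂ :* b₀)) refl
    regroupʳ : ∀ H P b₃ z₂ b₀ → H * P * (b₃ * z₂ * b₀) ≡ H * (P * b₃ * z₂ * b₀)
    regroupʳ = solve 5 (λ H P b₃ z₂ b₀ → H :* P :* (b₃ :* z₂ :* b₀) := H :* (P :* b₃ :* z₂ :* b₀)) refl

  -- One term of the induction step of B*B-expansion, multiplied by q^m q^i (m = k + j);
  -- here X = q^n, u = q^m, v = q^i.
  linearisation-step-algebra : ∀ {Q X u v w P P′ C B₀ B₁ t y₀ y₁ H} →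
    P′ ≡ P * X → w ≡ u * v → y₀ ≡ Q * (X * u) → y₁ ≡ Q * (X * v) →
    u * v ≢ 0ℚ →
    u * (B₁ * (t * t)) ≡ B₀ * ((u - X) * (1ℚ - y₀)) →
    H * w ≡ (v + Q * (u * (u * v))) - (u + Q * (u * (v * v))) →
    P * C * ((t * t) * B₁) * v + P′ * (H * C) * B₀ * v ≡ P * C * B₀ * ((v - X) * (1ℚ - y₁))
  linearisation-step-algebra {Q} {X} {u} {v} {P = P} {C = C} {B₀} {B₁} {t} {H = H}
    refl refl refl refl uv≢0 step hw = *-cancelʳ-≢0 uv≢0 (begin
      (P * C * ((t * t) * B₁) * v + P * X * (H * C) * B₀ * v) * (u * v)
        ≡⟨ regroupˡ P C t B₁ v X H B₀ u ⟩
      P * C * v * v * (u * (B₁ * (t * t))) + P * X * C * B₀ * v * (H * (u * v))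
        ≡⟨ cong₂ (λ a b → P * C * v * v * a + P * X * C * B₀ * v * b) step hw ⟩
      P * C * v * v * (B₀ * ((u - X) * (1ℚ - Q * (X * u))))
        + P * X * C * B₀ * v * ((v + Q * (u * (u * v))) - (u + Q * (u * (v * v))))
        ≡⟨ identity Q X u v P C B₀ ⟩
      P * C * B₀ * ((v - X) * (1ℚ - Q * (X * v))) * (u * v) ∎)
    where
    regroupˡ : ∀ P C t B₁ v X H B₀ u →
      (P * C * ((t * t) * B₁) * v + P * X * (H * C) * B₀ * v) * (u * v)
        ≡ P * C * v * v * (u * (B₁ * (t * t))) + P * X * C * B₀ * v * (H * (u * v))
    regroupˡ = solve 9 (λ P C t B₁ v X H B₀ u →
      (P :* C :* ((t :* t) :* B₁) :* v :+ P :* X :* (H :* C) :* B₀ :* v) :* (u :* v)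
        := P :* C :* v :* v :* (u :* (B₁ :* (t :* t))) :+ P :* X :* C :* B₀ :* v :* (H :* (u :* v))) refl
    identity : ∀ Q X u v P C B₀ →
      P * C * v * v * (B₀ * ((u - X) * (1ℚ - Q * (X * u))))
        + P * X * C * B₀ * v * ((v + Q * (u * (u * v))) - (u + Q * (u * (v * v))))
        ≡ P * C * B₀ * ((v - X) * (1ℚ - Q * (X * v))) * (u * v)
    identity = solve 7 (λ Q X u v P C B₀ →
      P :* C :* v :* v :* (B₀ :* ((u :- X) :* (con 1ℚ :- Q :* (X :* u))))
        :+ P :* X :* C :* B₀ :* v :* ((v :+ Q :* (u :* (u :* v))) :- (u :+ Q :* (u :* (v :* v))))
      := P :* C :* B₀ :* ((v :- X) :* (con 1ℚ :- Q :* (X :* v))) :* (u :* v)) refl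


  B : ℕ → ℕ → ℚ
  B n m = qbinom n m * qbinom (n ℕ.+ m) m

  G : ℕ → ℕ → ℚ
  G n m = (q^ m - q^ n) * (1ℚ - q^ suc (n ℕ.+ m))

  B-step : ∀ n m → q^ m * (B n (suc m) * ((1ℚ - q^ suc m) * (1ℚ - q^ suc m))) ≡ B n m * G n m
  B-step n m = begin
    q^ m * ((qbinom n (suc m) * qbinom (n ℕ.+ suc m) (suc m)) * (t * t))
      ≡⟨ cong (λ a → q^ m * ((qbinom n (suc m) * qbinom a (suc m)) * (t * t))) (ℕₚ.+-suc n m) ⟩
    q^ m * ((qbinom n (suc m) * qbinom (suc (n ℕ.+ m)) (suc m)) * (t * t))
      ≡⟨ regroup₁ (q^ m) (qbinom n (suc m)) (qbinom (suc (n ℕ.+ m)) (suc m)) t ⟩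
    (q^ m * (qbinom n (suc m) * t)) * (qbinom (suc (n ℕ.+ m)) (suc m) * t)
      ≡⟨ cong₂ _*_ (qbinom-sucʳ n m) (qbinom-absorb (n ℕ.+ m) m) ⟩
    (qbinom n m * (q^ m - q^ n)) * ((1ℚ - q^ suc (n ℕ.+ m)) * qbinom (n ℕ.+ m) m)
      ≡⟨ regroup₂ (qbinom n m) (q^ m - q^ n) (1ℚ - q^ suc (n ℕ.+ m)) (qbinom (n ℕ.+ m) m) ⟩
    (qbinom n m * qbinom (n ℕ.+ m) m) * ((q^ m - q^ n) * (1ℚ - q^ suc (n ℕ.+ m))) ∎
    where
    t = 1ℚ - q^ suc m
    regroup₁ : ∀ a x y t → a * ((x * y) * (t * t)) ≡ (a * (x * t)) * (y * t)
    regroup₁ = solve 4 (λ a x y t → a :* ((x :* y) :* (t :* t)) := (a :* (x :* t)) :* (y :* t)) refl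
    regroup₂ : ∀ x y z w → (x * y) * (z * w) ≡ (x * w) * (y * z)
    regroup₂ = solve 4 (λ x y z w → (x :* y) :* (z :* w) := (x :* w) :* (y :* z)) refl

  av : ℕ → ℚ
  av t = q^ℤ (ℤ.- + t) + q^ suc t

  h : ℕ → ℕ → ℕ → ℚ
  h k i j = av (k ℕ.+ j) - av i

  h-*-q^ℤ : ∀ k i j e → h k i j * q^ℤ e
    ≡ (q^ℤ (ℤ.- + (k ℕ.+ j) ℤ.+ e) + q^ℤ (+ suc (k ℕ.+ j) ℤ.+ e))
      - (q^ℤ (ℤ.- + i ℤ.+ e) + q^ℤ (+ suc i ℤ.+ e))
  h-*-q^ℤ k i j e = begin
    h k i j * q^ℤ e
      ≡⟨ distrib (q^ℤ (ℤ.- + (k ℕ.+ j))) (q^ suc (k ℕ.+ j)) (q^ℤ (ℤ.- + i)) (q^ suc i) (q^ℤ e) ⟩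
    (q^ℤ (ℤ.- + (k ℕ.+ j)) * q^ℤ e + q^ suc (k ℕ.+ j) * q^ℤ e) - (q^ℤ (ℤ.- + i) * q^ℤ e + q^ suc i * q^ℤ e)
      ≡⟨ sym (cong₂ _-_ (cong₂ _+_ (q^ℤ-+ (ℤ.- + (k ℕ.+ j)) e) (q^ℤ-+ (+ suc (k ℕ.+ j)) e))
                       (cong₂ _+_ (q^ℤ-+ (ℤ.- + i) e) (q^ℤ-+ (+ suc i) e))) ⟩
    (q^ℤ (ℤ.- + (k ℕ.+ j) ℤ.+ e) + q^ℤ (+ suc (k ℕ.+ j) ℤ.+ e)) - (q^ℤ (ℤ.- + i ℤ.+ e) + q^ℤ (+ suc i ℤ.+ e)) ∎
    where
    distrib : ∀ a b c d x → ((a + b) - (c + d)) * x ≡ (a * x + b * x) - (c * x + d * x)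
    distrib = solve 5 (λ a b c d x → ((a :+ b) :- (c :+ d)) :* x := (a :* x :+ b :* x) :- (c :* x :+ d :* x)) refl

  c : ℕ → ℕ → ℕ → ℚ
  c k i j = q^ℤ ((+ j ℤ.- + i) ℤ.* + (j ℕ.+ k)) * qbinom (k ℕ.+ i) i
            * qbinomℤ (+ k) (+ i ℤ.- + j) * qbinom (k ℕ.+ j) j

  c-above : ∀ k i j → i < j → c k i j ≡ 0ℚ
  c-above k i j i<j = trans (cong (λ z → q^ℤ ((+ j ℤ.- + i) ℤ.* + (j ℕ.+ k)) * qbinom (k ℕ.+ i) i * z * qbinom (k ℕ.+ j) j)
                                  (qbinomℤ-< k i j i<j))
                            (vanish (q^ℤ ((+ j ℤ.- + i) ℤ.* + (j ℕ.+ k))) (qbinom (k ℕ.+ i) i) (qbinom (k ℕ.+ j) j))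
    where
    vanish : ∀ x y z → x * y * 0ℚ * z ≡ 0ℚ
    vanish = solve 3 (λ x y z → x :* y :* con 0ℚ :* z := con 0ℚ) refl

  c-diagonal : ∀ k i → c k i i ≡ qbinom (k ℕ.+ i) i * qbinom (k ℕ.+ i) i
  c-diagonal k i = begin
    q^ℤ ((+ i ℤ.- + i) ℤ.* + (i ℕ.+ k)) * qbinom (k ℕ.+ i) i * qbinomℤ (+ k) (+ i ℤ.- + i) * qbinom (k ℕ.+ i) i
      ≡⟨ cong₂ (λ x y → x * qbinom (k ℕ.+ i) i * y * qbinom (k ℕ.+ i) i) exponent-zero binomial-one ⟩
    1ℚ * qbinom (k ℕ.+ i) i * 1ℚ * qbinom (k ℕ.+ i) i
      ≡⟨ drop-ones (qbinom (k ℕ.+ i) i) ⟩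
    qbinom (k ℕ.+ i) i * qbinom (k ℕ.+ i) i ∎
    where
    exponent-zero : q^ℤ ((+ i ℤ.- + i) ℤ.* + (i ℕ.+ k)) ≡ 1ℚ
    exponent-zero = cong q^ℤ_ (cong (ℤ._* + (i ℕ.+ k)) (ℤₚ.+-inverseʳ (+ i)))
    binomial-one : qbinomℤ (+ k) (+ i ℤ.- + i) ≡ 1ℚ
    binomial-one = trans (qbinomℤ-≥ k i i ℕₚ.≤-refl) (trans (cong (qbinom k) (ℕₚ.n∸n≡0 i)) (qbinom-zeroʳ k))
    drop-ones : ∀ x → 1ℚ * x * 1ℚ * x ≡ x * x
    drop-ones = solve 1 (λ x → con 1ℚ :* x :* con 1ℚ :* x := x :* x) refl

  c-step-below : ∀ k j s → let i = suc (s ℕ.+ j) in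
    (1ℚ - q^ suc i) * (1ℚ - q^ suc i) * c k (suc i) (suc j)
      ≡ (1ℚ - q^ suc (k ℕ.+ j)) * (1ℚ - q^ suc (k ℕ.+ j)) * c k i j + h k i (suc j) * c k i (suc j)
  c-step-below k j s = c-step-algebra {Q = q^ 1} {A = q^ j} {K = q^ k} {S = q^ s} {U = q^ℤ u₀}
    {H = h k (suc (s ℕ.+ j)) (suc j)}
    (q^ℤ-sum (+ 1 ∷ + 1 ∷ + s ∷ + j ∷ []) refl)
    (q^ℤ-sum (+ 1 ∷ + k ∷ + j ∷ []) refl)
    (q^ℤ-sum (+ 1 ∷ + k ∷ + 1 ∷ + s ∷ + j ∷ []) refl)
    (q^ℤ-sum (+ 1 ∷ + j ∷ []) refl)
    (q^ℤ-sum (+ 1 ∷ + s ∷ []) refl)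
    (q^ℤ-sum (u₀ ∷ + s ∷ []) (exp₁ (+ j) (+ s) (+ k)))
    (q^ℤ-sum (u₀ ∷ + 1 ∷ + s ∷ + s ∷ []) (exp₂ (+ j) (+ s) (+ k)))
    (q^ℤ-sum (u₀ ∷ + s ∷ + 1 ∷ + j ∷ + k ∷ []) (exp₃ (+ j) (+ s) (+ k)))
    (trans (h-*-q^ℤ k (suc (s ℕ.+ j)) (suc j) e₃) (cong₂ _-_
      (cong₂ _+_ (q^ℤ-sum (u₀ ∷ + s ∷ []) (exp₄ (+ j) (+ s) (+ k)))
                 (q^ℤ-sum (u₀ ∷ + s ∷ + 1 ∷ + 1 ∷ + 1 ∷ + j ∷ + j ∷ + k ∷ + k ∷ []) (exp₅ (+ j) (+ s) (+ k))))
      (cong₂ _+_ (q^ℤ-sum (u₀ ∷ + k ∷ []) (exp₆ (+ j) (+ s) (+ k)))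
                 (q^ℤ-sum (u₀ ∷ + s ∷ + s ∷ + 1 ∷ + 1 ∷ + 1 ∷ + j ∷ + j ∷ + k ∷ []) (exp₇ (+ j) (+ s) (+ k))))))
    (*-≢0 (1-q^suc≢0 s) (1-q^suc≢0 j))
    (trans (cong (λ a → qbinom a (suc (suc (s ℕ.+ j))) * (1ℚ - q^ suc (suc (s ℕ.+ j)))) (ℕₚ.+-suc k (suc (s ℕ.+ j))))
           (qbinom-absorb (k ℕ.+ suc (s ℕ.+ j)) (suc (s ℕ.+ j))))
    (trans (cong (λ a → qbinom a (suc j) * (1ℚ - q^ suc j)) (ℕₚ.+-suc k j)) (qbinom-absorb (k ℕ.+ j) j))
    (qbinom-sucʳ k s)
    (trans (qbinomℤ-≥ k (suc (suc (s ℕ.+ j))) (suc j) (s≤s (ℕₚ.m≤n+m j (suc s)))) (cong (qbinom k) (ℕₚ.m+n∸n≡m (suc s) j)))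
    (trans (qbinomℤ-≥ k (suc (s ℕ.+ j)) j (ℕₚ.m≤n+m j (suc s))) (cong (qbinom k) (ℕₚ.m+n∸n≡m (suc s) j)))
    (trans (qbinomℤ-≥ k (suc (s ℕ.+ j)) (suc j) (s≤s (ℕₚ.m≤n+m j s))) (cong (qbinom k) (ℕₚ.m+n∸n≡m s j)))
    where
    e₃ : ℤ
    e₃ = (+ suc j ℤ.- + suc (s ℕ.+ j)) ℤ.* + (suc j ℕ.+ k)
    u₀ : ℤ
    u₀ = (+ suc j ℤ.- + suc (suc (s ℕ.+ j))) ℤ.* + (suc j ℕ.+ k) ℤ.- + s
    exp₁ : ∀ J S K → ((+ 1 ℤ.+ J) ℤ.- (+ 2 ℤ.+ (S ℤ.+ J))) ℤ.* ((+ 1 ℤ.+ J) ℤ.+ K)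
      ≡ (((+ 1 ℤ.+ J) ℤ.- (+ 2 ℤ.+ (S ℤ.+ J))) ℤ.* ((+ 1 ℤ.+ J) ℤ.+ K) ℤ.- S) ℤ.+ S
    exp₁ = solve-∀
    exp₂ : ∀ J S K → (J ℤ.- (+ 1 ℤ.+ (S ℤ.+ J))) ℤ.* (J ℤ.+ K)
      ≡ (((+ 1 ℤ.+ J) ℤ.- (+ 2 ℤ.+ (S ℤ.+ J))) ℤ.* ((+ 1 ℤ.+ J) ℤ.+ K) ℤ.- S) ℤ.+ (+ 1 ℤ.+ (S ℤ.+ S))
    exp₂ = solve-∀
    exp₃ : ∀ J S K → ((+ 1 ℤ.+ J) ℤ.- (+ 1 ℤ.+ (S ℤ.+ J))) ℤ.* ((+ 1 ℤ.+ J) ℤ.+ K)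
      ≡ (((+ 1 ℤ.+ J) ℤ.- (+ 2 ℤ.+ (S ℤ.+ J))) ℤ.* ((+ 1 ℤ.+ J) ℤ.+ K) ℤ.- S) ℤ.+ (S ℤ.+ (+ 1 ℤ.+ (J ℤ.+ K)))
    exp₃ = solve-∀
    exp₄ : ∀ J S K → ℤ.- (K ℤ.+ (+ 1 ℤ.+ J)) ℤ.+ ((+ 1 ℤ.+ J) ℤ.- (+ 1 ℤ.+ (S ℤ.+ J))) ℤ.* ((+ 1 ℤ.+ J) ℤ.+ K)
      ≡ (((+ 1 ℤ.+ J) ℤ.- (+ 2 ℤ.+ (S ℤ.+ J))) ℤ.* ((+ 1 ℤ.+ J) ℤ.+ K) ℤ.- S) ℤ.+ S
    exp₄ = solve-∀
    exp₅ : ∀ J S K → (+ 1 ℤ.+ (K ℤ.+ (+ 1 ℤ.+ J))) ℤ.+ ((+ 1 ℤ.+ J) ℤ.- (+ 1 ℤ.+ (S ℤ.+ J))) ℤ.* ((+ 1 ℤ.+ J) ℤ.+ K)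
      ≡ (((+ 1 ℤ.+ J) ℤ.- (+ 2 ℤ.+ (S ℤ.+ J))) ℤ.* ((+ 1 ℤ.+ J) ℤ.+ K) ℤ.- S)
        ℤ.+ (S ℤ.+ (+ 1 ℤ.+ (+ 1 ℤ.+ (+ 1 ℤ.+ (J ℤ.+ (J ℤ.+ (K ℤ.+ K)))))))
    exp₅ = solve-∀
    exp₆ : ∀ J S K → ℤ.- (+ 1 ℤ.+ (S ℤ.+ J)) ℤ.+ ((+ 1 ℤ.+ J) ℤ.- (+ 1 ℤ.+ (S ℤ.+ J))) ℤ.* ((+ 1 ℤ.+ J) ℤ.+ K)
      ≡ (((+ 1 ℤ.+ J) ℤ.- (+ 2 ℤ.+ (S ℤ.+ J))) ℤ.* ((+ 1 ℤ.+ J) ℤ.+ K) ℤ.- S) ℤ.+ K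
    exp₆ = solve-∀
    exp₇ : ∀ J S K → (+ 2 ℤ.+ (S ℤ.+ J)) ℤ.+ ((+ 1 ℤ.+ J) ℤ.- (+ 1 ℤ.+ (S ℤ.+ J))) ℤ.* ((+ 1 ℤ.+ J) ℤ.+ K)
      ≡ (((+ 1 ℤ.+ J) ℤ.- (+ 2 ℤ.+ (S ℤ.+ J))) ℤ.* ((+ 1 ℤ.+ J) ℤ.+ K) ℤ.- S)
        ℤ.+ (S ℤ.+ (S ℤ.+ (+ 1 ℤ.+ (+ 1 ℤ.+ (+ 1 ℤ.+ (J ℤ.+ (J ℤ.+ K)))))))
    exp₇ = solve-∀

  c-step-zero : ∀ k i → (1ℚ - q^ suc i) * (1ℚ - q^ suc i) * c k (suc i) 0 ≡ h k i 0 * c k i 0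
  c-step-zero k i = c-step-zero-algebra {Q = q^ 1} {V = q^ i} {K = q^ k} {U = q^ℤ u₀} {H = h k i 0}
    (q^ℤ-sum (+ 1 ∷ + i ∷ []) refl)
    (q^ℤ-sum (+ 1 ∷ + k ∷ + i ∷ []) refl)
    (q^ℤ-sum (u₀ ∷ + i ∷ []) (exp₁ (+ i) (+ k)))
    (q^ℤ-sum (u₀ ∷ + i ∷ + k ∷ []) (exp₂ (+ i) (+ k)))
    (trans (h-*-q^ℤ k i 0 e₂) (cong₂ _-_
      (cong₂ _+_ (q^ℤ-sum (u₀ ∷ + i ∷ []) (exp₃ (+ i) (+ k)))
                 (q^ℤ-sum (u₀ ∷ + i ∷ + k ∷ + k ∷ + 1 ∷ []) (exp₄ (+ i) (+ k))))
      (cong₂ _+_ (q^ℤ-sum (u₀ ∷ + k ∷ []) (exp₅ (+ i) (+ k)))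
                 (q^ℤ-sum (u₀ ∷ + i ∷ + i ∷ + k ∷ + 1 ∷ []) (exp₆ (+ i) (+ k))))))
    (trans (cong (λ a → qbinom a (suc i) * (1ℚ - q^ suc i)) (ℕₚ.+-suc k i)) (qbinom-absorb (k ℕ.+ i) i))
    (qbinom-sucʳ k i)
    (qbinomℤ-≥ k (suc i) 0 z≤n)
    (qbinomℤ-≥ k i 0 z≤n)
    where
    e₂ : ℤ
    e₂ = (+ 0 ℤ.- + i) ℤ.* + (0 ℕ.+ k)
    u₀ : ℤ
    u₀ = (+ 0 ℤ.- + suc i) ℤ.* + (0 ℕ.+ k) ℤ.- + i
    exp₁ : ∀ I K → (+ 0 ℤ.- (+ 1 ℤ.+ I)) ℤ.* (+ 0 ℤ.+ K) ≡ ((+ 0 ℤ.- (+ 1 ℤ.+ I)) ℤ.* (+ 0 ℤ.+ K) ℤ.- I) ℤ.+ I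
    exp₁ = solve-∀
    exp₂ : ∀ I K → (+ 0 ℤ.- I) ℤ.* (+ 0 ℤ.+ K) ≡ ((+ 0 ℤ.- (+ 1 ℤ.+ I)) ℤ.* (+ 0 ℤ.+ K) ℤ.- I) ℤ.+ (I ℤ.+ K)
    exp₂ = solve-∀
    exp₃ : ∀ I K → ℤ.- (K ℤ.+ + 0) ℤ.+ (+ 0 ℤ.- I) ℤ.* (+ 0 ℤ.+ K)
      ≡ ((+ 0 ℤ.- (+ 1 ℤ.+ I)) ℤ.* (+ 0 ℤ.+ K) ℤ.- I) ℤ.+ I
    exp₃ = solve-∀
    exp₄ : ∀ I K → (+ 1 ℤ.+ (K ℤ.+ + 0)) ℤ.+ (+ 0 ℤ.- I) ℤ.* (+ 0 ℤ.+ K)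
      ≡ ((+ 0 ℤ.- (+ 1 ℤ.+ I)) ℤ.* (+ 0 ℤ.+ K) ℤ.- I) ℤ.+ (I ℤ.+ (K ℤ.+ (K ℤ.+ + 1)))
    exp₄ = solve-∀
    exp₅ : ∀ I K → ℤ.- I ℤ.+ (+ 0 ℤ.- I) ℤ.* (+ 0 ℤ.+ K) ≡ ((+ 0 ℤ.- (+ 1 ℤ.+ I)) ℤ.* (+ 0 ℤ.+ K) ℤ.- I) ℤ.+ K
    exp₅ = solve-∀
    exp₆ : ∀ I K → (+ 1 ℤ.+ I) ℤ.+ (+ 0 ℤ.- I) ℤ.* (+ 0 ℤ.+ K)
      ≡ ((+ 0 ℤ.- (+ 1 ℤ.+ I)) ℤ.* (+ 0 ℤ.+ K) ℤ.- I) ℤ.+ (I ℤ.+ (I ℤ.+ (K ℤ.+ + 1)))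
    exp₆ = solve-∀

  c-step : ∀ k i j →
    (1ℚ - q^ suc i) * (1ℚ - q^ suc i) * c k (suc i) (suc j)
      ≡ (1ℚ - q^ suc (k ℕ.+ j)) * (1ℚ - q^ suc (k ℕ.+ j)) * c k i j + h k i (suc j) * c k i (suc j)
  c-step k i j with ℕₚ.<-cmp j i
  ... | tri< j<i _ _ = subst (λ i → (1ℚ - q^ suc i) * (1ℚ - q^ suc i) * c k (suc i) (suc j)
                                      ≡ (1ℚ - q^ suc (k ℕ.+ j)) * (1ℚ - q^ suc (k ℕ.+ j)) * c k i j
                                        + h k i (suc j) * c k i (suc j))
                             (trans (sym (ℕₚ.+-suc (i ∸ suc j) j)) (ℕₚ.m∸n+n≡m j<i))
                             (c-step-below k j (i ∸ suc j))
  ... | tri≈ _ refl _ = begin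
    t * t * c k (suc i) (suc i)              ≡⟨ cong (t * t *_) (c-diagonal k (suc i)) ⟩
    t * t * (β′ * β′)                        ≡⟨ square t β′ ⟩
    (β′ * t) * (β′ * t)                      ≡⟨ cong₂ _*_ absorb absorb ⟩
    ((1ℚ - y) * β) * ((1ℚ - y) * β)          ≡⟨ square-plus-zero y β (h k i (suc i)) ⟩
    (1ℚ - y) * (1ℚ - y) * (β * β) + h k i (suc i) * 0ℚ
      ≡⟨ sym (cong₂ (λ x z → (1ℚ - y) * (1ℚ - y) * x + h k i (suc i) * z)
                    (c-diagonal k i) (c-above k i (suc i) ℕₚ.≤-refl)) ⟩
    (1ℚ - y) * (1ℚ - y) * c k i i + h k i (suc i) * c k i (suc i) ∎
    where
    t = 1ℚ - q^ suc i
    y = q^ suc (k ℕ.+ i)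
    β = qbinom (k ℕ.+ i) i
    β′ = qbinom (k ℕ.+ suc i) (suc i)
    absorb : β′ * t ≡ (1ℚ - y) * β
    absorb = trans (cong (λ a → qbinom a (suc i) * t) (ℕₚ.+-suc k i)) (qbinom-absorb (k ℕ.+ i) i)
    square : ∀ t β → t * t * (β * β) ≡ (β * t) * (β * t)
    square = solve 2 (λ t β → t :* t :* (β :* β) := (β :* t) :* (β :* t)) refl
    square-plus-zero : ∀ y β H → ((1ℚ - y) * β) * ((1ℚ - y) * β) ≡ (1ℚ - y) * (1ℚ - y) * (β * β) + H * 0ℚ
    square-plus-zero = solve 3 (λ y β H → ((con 1ℚ :- y) :* β) :* ((con 1ℚ :- y) :* β)
                                       := (con 1ℚ :- y) :* (con 1ℚ :- y) :* (β :* β) :+ H :* con 0ℚ) refl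
  ... | tri> _ _ i<j = begin
    t * t * c k (suc i) (suc j)      ≡⟨ cong (t * t *_) (c-above k (suc i) (suc j) (s≤s i<j)) ⟩
    t * t * 0ℚ                       ≡⟨ zeros t y (h k i (suc j)) ⟩
    (1ℚ - y) * (1ℚ - y) * 0ℚ + h k i (suc j) * 0ℚ
      ≡⟨ sym (cong₂ (λ x z → (1ℚ - y) * (1ℚ - y) * x + h k i (suc j) * z)
                    (c-above k i j i<j) (c-above k i (suc j) (ℕₚ.m<n⇒m<1+n i<j))) ⟩
    (1ℚ - y) * (1ℚ - y) * c k i j + h k i (suc j) * c k i (suc j) ∎
    where
    t = 1ℚ - q^ suc i
    y = q^ suc (k ℕ.+ j)
    zeros : ∀ t y H → t * t * 0ℚ ≡ (1ℚ - y) * (1ℚ - y) * 0ℚ + H * 0ℚ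
    zeros = solve 3 (λ t y H → t :* t :* con 0ℚ := (con 1ℚ :- y) :* (con 1ℚ :- y) :* con 0ℚ :+ H :* con 0ℚ) refl

  T : ℕ → ℕ → ℕ → ℕ → ℚ
  T n k i j = q^ℤ ((+ i ℤ.- + j) ℤ.* + n) * c k i j * B n (k ℕ.+ j)

  private
    V : ℕ → ℕ → ℕ → ℕ → ℚ
    V n k i j = q^ℤ ((+ suc i ℤ.- + j) ℤ.* + n) * (h k i j * c k i j) * B n (k ℕ.+ j) * q^ i

    W : ℕ → ℕ → ℕ → ℕ → ℚ
    W n k i j = q^ℤ ((+ i ℤ.- + j) ℤ.* + n) * c k i j
                * ((1ℚ - q^ suc (k ℕ.+ j)) * (1ℚ - q^ suc (k ℕ.+ j)) * B n (suc (k ℕ.+ j))) * q^ i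

    T-step-G : ∀ n k i j → W n k i j + V n k i j ≡ T n k i j * G n i
    T-step-G n k i j = linearisation-step-algebra {Q = q^ 1} {X = q^ n} {u = q^ (k ℕ.+ j)} {v = q^ i}
      {P = q^ℤ ((+ i ℤ.- + j) ℤ.* + n)} {C = c k i j} {B₀ = B n (k ℕ.+ j)} {B₁ = B n (suc (k ℕ.+ j))}
      {t = 1ℚ - q^ suc (k ℕ.+ j)} {H = h k i j}
      (q^ℤ-sum ((+ i ℤ.- + j) ℤ.* + n ∷ + n ∷ []) (shift (+ i) (+ j) (+ n)))
      (q^ℤ-sum (+ (k ℕ.+ j) ∷ + i ∷ []) refl)
      (q^ℤ-sum (+ 1 ∷ + n ∷ + (k ℕ.+ j) ∷ []) refl)
      (q^ℤ-sum (+ 1 ∷ + n ∷ + i ∷ []) refl)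
      (*-≢0 (q^≢0 (k ℕ.+ j)) (q^≢0 i))
      (B-step n (k ℕ.+ j))
      (trans (h-*-q^ℤ k i j (+ (k ℕ.+ j) ℤ.+ + i)) (cong₂ _-_
        (cong₂ _+_ (q^ℤ-sum (+ i ∷ []) (exp₁ (+ (k ℕ.+ j)) (+ i)))
                   (q^ℤ-sum (+ 1 ∷ + (k ℕ.+ j) ∷ + (k ℕ.+ j) ∷ + i ∷ []) (exp₂ (+ (k ℕ.+ j)) (+ i))))
        (cong₂ _+_ (q^ℤ-sum (+ (k ℕ.+ j) ∷ []) (exp₃ (+ (k ℕ.+ j)) (+ i)))
                   (q^ℤ-sum (+ 1 ∷ + (k ℕ.+ j) ∷ + i ∷ + i ∷ []) (exp₄ (+ (k ℕ.+ j)) (+ i))))))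
      where
      shift : ∀ I J N → ((+ 1 ℤ.+ I) ℤ.- J) ℤ.* N ≡ (I ℤ.- J) ℤ.* N ℤ.+ N
      shift = solve-∀
      exp₁ : ∀ M I → ℤ.- M ℤ.+ (M ℤ.+ I) ≡ I
      exp₁ = solve-∀
      exp₂ : ∀ M I → (+ 1 ℤ.+ M) ℤ.+ (M ℤ.+ I) ≡ + 1 ℤ.+ (M ℤ.+ (M ℤ.+ I))
      exp₂ = solve-∀
      exp₃ : ∀ M I → ℤ.- I ℤ.+ (M ℤ.+ I) ≡ M
      exp₃ = solve-∀
      exp₄ : ∀ M I → (+ 1 ℤ.+ I) ℤ.+ (M ℤ.+ I) ≡ + 1 ℤ.+ (M ℤ.+ (I ℤ.+ I))
      exp₄ = solve-∀

    regroup : ∀ P C B a t → P * C * B * (a * (t * t)) ≡ P * (t * t * C) * B * a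
    regroup = solve 5 (λ P C B a t → P :* C :* B :* (a :* (t :* t)) := P :* (t :* t :* C) :* B :* a) refl

    T-suc-suc : ∀ n k i j → T n k (suc i) (suc j) * (q^ i * ((1ℚ - q^ suc i) * (1ℚ - q^ suc i)))
      ≡ W n k i j + V n k i (suc j)
    T-suc-suc n k i j = begin
      P * c k (suc i) (suc j) * B′ * (q^ i * (t * t))
        ≡⟨ regroup P (c k (suc i) (suc j)) B′ (q^ i) t ⟩
      P * (t * t * c k (suc i) (suc j)) * B′ * q^ i
        ≡⟨ cong (λ x → P * x * B′ * q^ i) (c-step k i j) ⟩
      P * (y * y * c k i j + h k i (suc j) * c k i (suc j)) * B′ * q^ i
        ≡⟨ distrib P (y * y) (c k i j) (h k i (suc j) * c k i (suc j)) B′ (q^ i) ⟩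
      P * c k i j * (y * y * B′) * q^ i + V n k i (suc j)
        ≡⟨ cong₂ (λ e m → q^ℤ (e ℤ.* + n) * c k i j * (y * y * B n m) * q^ i + V n k i (suc j))
                 (shift (+ i) (+ j)) (ℕₚ.+-suc k j) ⟩
      W n k i j + V n k i (suc j) ∎
      where
      P = q^ℤ ((+ suc i ℤ.- + suc j) ℤ.* + n)
      B′ = B n (k ℕ.+ suc j)
      t = 1ℚ - q^ suc i
      y = 1ℚ - q^ suc (k ℕ.+ j)
      distrib : ∀ P X C HC B a → P * (X * C + HC) * B * a ≡ P * C * (X * B) * a + P * HC * B * a
      distrib = solve 6 (λ P X C HC B a → P :* (X :* C :+ HC) :* B :* a
                                       := P :* C :* (X :* B) :* a :+ P :* HC :* B :* a) refl
      shift : ∀ I J → (+ 1 ℤ.+ I) ℤ.- (+ 1 ℤ.+ J) ≡ I ℤ.- J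
      shift = solve-∀

    T-suc-zero : ∀ n k i → T n k (suc i) 0 * (q^ i * ((1ℚ - q^ suc i) * (1ℚ - q^ suc i))) ≡ V n k i 0
    T-suc-zero n k i = trans (regroup P (c k (suc i) 0) (B n (k ℕ.+ 0)) (q^ i) (1ℚ - q^ suc i))
                             (cong (λ x → P * x * B n (k ℕ.+ 0) * q^ i) (c-step-zero k i))
      where
      P = q^ℤ ((+ suc i ℤ.- + 0) ℤ.* + n)

  -- By induction on i: B-step gives B n (i + 1) from B n i, and c-step is the matching recurrence
  -- for the coefficients.
  B*B-expansion : ∀ n k i M → i < M → B n k * B n i ≡ ∑ M (T n k i)
  B*B-expansion n k zero (suc M) _ = begin
    B n k * (qbinom n 0 * qbinom (n ℕ.+ 0) 0) ≡⟨ cong₂ (λ x y → B n k * (x * y)) (qbinom-zeroʳ n) (qbinom-zeroʳ (n ℕ.+ 0)) ⟩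
    B n k * 1ℚ                                 ≡⟨ ℚₚ.*-identityʳ (B n k) ⟩
    B n k                                      ≡⟨ sym T₀₀ ⟩
    T n k 0 0                                  ≡⟨ sym (ℚₚ.+-identityʳ (T n k 0 0)) ⟩
    T n k 0 0 + 0ℚ                             ≡⟨ cong (_+_ (T n k 0 0)) (sym (∑-zero M (λ j → T n k 0 (suc j)) T₀ₛ)) ⟩
    T n k 0 0 + ∑ M (λ j → T n k 0 (suc j))    ≡⟨ sym (∑-suc-head M (T n k 0)) ⟩
    ∑ (suc M) (T n k 0)                        ∎
    where
    T₀₀ : T n k 0 0 ≡ B n k
    T₀₀ = begin
      1ℚ * c k 0 0 * B n (k ℕ.+ 0)   ≡⟨ cong₂ (λ x m → 1ℚ * x * B n m) (c-diagonal k 0) (ℕₚ.+-identityʳ k) ⟩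
      1ℚ * (qbinom (k ℕ.+ 0) 0 * qbinom (k ℕ.+ 0) 0) * B n k
        ≡⟨ cong (λ x → 1ℚ * (x * x) * B n k) (qbinom-zeroʳ (k ℕ.+ 0)) ⟩
      1ℚ * (1ℚ * 1ℚ) * B n k         ≡⟨ ℚₚ.*-identityˡ (B n k) ⟩
      B n k                          ∎
    T₀ₛ : ∀ j → j < M → T n k 0 (suc j) ≡ 0ℚ
    T₀ₛ j _ = trans (cong (λ x → q^ℤ ((+ 0 ℤ.- + suc j) ℤ.* + n) * x * B n (k ℕ.+ suc j)) (c-above k 0 (suc j) (s≤s z≤n)))
                    (trans (cong (_* B n (k ℕ.+ suc j)) (ℚₚ.*-zeroʳ (q^ℤ ((+ 0 ℤ.- + suc j) ℤ.* + n)))) (ℚₚ.*-zeroˡ (B n (k ℕ.+ suc j))))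
  B*B-expansion n k (suc i) (suc M) (s≤s i<M) = *-cancelʳ-≢0 Z≢0 (begin
    B n k * B n (suc i) * Z                   ≡⟨ regroup₁ (B n k) (B n (suc i)) (q^ i) (t * t) ⟩
    B n k * (q^ i * (B n (suc i) * (t * t)))  ≡⟨ cong (B n k *_) (B-step n i) ⟩
    B n k * (B n i * G n i)                   ≡⟨ sym (ℚₚ.*-assoc (B n k) (B n i) (G n i)) ⟩
    B n k * B n i * G n i                     ≡⟨ cong (_* G n i) (B*B-expansion n k i M i<M) ⟩
    ∑ M (T n k i) * G n i                     ≡⟨ ∑-distribʳ-* M (T n k i) (G n i) ⟩
    ∑ M (λ j → T n k i j * G n i)             ≡⟨ sym (∑-cong M (λ j _ → T-step-G n k i j)) ⟩
    ∑ M (λ j → W n k i j + V n k i j)         ≡⟨ ∑-distrib-+ M (W n k i) (V n k i) ⟩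
    ∑ M (W n k i) + ∑ M (V n k i)             ≡⟨ cong (_+_ (∑ M (W n k i))) (sym (∑-zero-tail M (suc M) (V n k i) (ℕₚ.n≤1+n M) V-tail)) ⟩
    ∑ M (W n k i) + ∑ (suc M) (V n k i)       ≡⟨ cong (_+_ (∑ M (W n k i))) (∑-suc-head M (V n k i)) ⟩
    ∑ M (W n k i) + (V n k i 0 + ∑ M (λ j → V n k i (suc j)))
      ≡⟨ swap (∑ M (W n k i)) (V n k i 0) (∑ M (λ j → V n k i (suc j))) ⟩
    V n k i 0 + (∑ M (W n k i) + ∑ M (λ j → V n k i (suc j)))
      ≡⟨ cong (_+_ (V n k i 0)) (sym (∑-distrib-+ M (W n k i) (λ j → V n k i (suc j)))) ⟩
    V n k i 0 + ∑ M (λ j → W n k i j + V n k i (suc j))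
      ≡⟨ sym (cong₂ _+_ (T-suc-zero n k i) (∑-cong M (λ j _ → T-suc-suc n k i j))) ⟩
    T n k (suc i) 0 * Z + ∑ M (λ j → T n k (suc i) (suc j) * Z)
      ≡⟨ sym (∑-suc-head M (λ j → T n k (suc i) j * Z)) ⟩
    ∑ (suc M) (λ j → T n k (suc i) j * Z)     ≡⟨ sym (∑-distribʳ-* (suc M) (T n k (suc i)) Z) ⟩
    ∑ (suc M) (T n k (suc i)) * Z             ∎)
    where
    t = 1ℚ - q^ suc i
    Z = q^ i * (t * t)
    Z≢0 : Z ≢ 0ℚ
    Z≢0 = *-≢0 (q^≢0 i) (*-≢0 (1-q^suc≢0 i) (1-q^suc≢0 i))
    regroup₁ : ∀ a B a′ z → a * B * (a′ * z) ≡ a * (a′ * (B * z))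
    regroup₁ = solve 4 (λ a B a′ z → a :* B :* (a′ :* z) := a :* (a′ :* (B :* z))) refl
    swap : ∀ a b c → a + (b + c) ≡ b + (a + c)
    swap = solve 3 (λ a b c → a :+ (b :+ c) := b :+ (a :+ c)) refl
    V-tail : ∀ j → M ≤ j → j < suc M → V n k i j ≡ 0ℚ
    V-tail j M≤j _ = trans (cong (λ x → q^ℤ ((+ suc i ℤ.- + j) ℤ.* + n) * (h k i j * x) * B n (k ℕ.+ j) * q^ i)
                                 (c-above k i j (ℕₚ.<-≤-trans i<M M≤j)))
                           (vanish (q^ℤ ((+ suc i ℤ.- + j) ℤ.* + n)) (h k i j) (B n (k ℕ.+ j)) (q^ i))
      where
      vanish : ∀ P H B a → P * (H * 0ℚ) * B * a ≡ 0ℚ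
      vanish = solve 4 (λ P H B a → P :* (H :* con 0ℚ) :* B :* a := con 0ℚ) refl

module Evaluation (b : ℕ) where
  open Rational
  open Powers b
  open Binomials b

  evalList : List ℕ → ℚ
  evalList []       = 0ℚ
  evalList (x ∷ xs) = fromℕ x + q * evalList xs

  eval : LPoly → ℚ
  eval (lp a xs) = q^ℤ a * evalList xs

  _^ℚ_ : ℚ → ℕ → ℚ
  x ^ℚ zero  = 1ℚ
  x ^ℚ suc r = x * x ^ℚ r

  evalList-addL : ∀ xs ys → evalList (addL xs ys) ≡ evalList xs + evalList ys
  evalList-addL []       ys       = sym (ℚₚ.+-identityˡ (evalList ys))
  evalList-addL (x ∷ xs) []       = sym (ℚₚ.+-identityʳ (evalList (x ∷ xs)))
  evalList-addL (x ∷ xs) (y ∷ ys) = begin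
    fromℕ (x ℕ.+ y) + q * evalList (addL xs ys)
      ≡⟨ cong₂ (λ a c → a + q * c) (fromℕ-+ x y) (evalList-addL xs ys) ⟩
    (fromℕ x + fromℕ y) + q * (evalList xs + evalList ys)
      ≡⟨ regroup (fromℕ x) (fromℕ y) q (evalList xs) (evalList ys) ⟩
    (fromℕ x + q * evalList xs) + (fromℕ y + q * evalList ys) ∎
    where
    regroup : ∀ a c Q X Y → (a + c) + Q * (X + Y) ≡ (a + Q * X) + (c + Q * Y)
    regroup = solve 5 (λ a c Q X Y → (a :+ c) :+ Q :* (X :+ Y) := (a :+ Q :* X) :+ (c :+ Q :* Y)) refl

  evalList-scaleL : ∀ x ys → evalList (scaleL x ys) ≡ fromℕ x * evalList ys
  evalList-scaleL x []       = sym (ℚₚ.*-zeroʳ (fromℕ x))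
  evalList-scaleL x (y ∷ ys) = begin
    fromℕ (x ℕ.* y) + q * evalList (scaleL x ys)
      ≡⟨ cong₂ (λ a c → a + q * c) (fromℕ-* x y) (evalList-scaleL x ys) ⟩
    fromℕ x * fromℕ y + q * (fromℕ x * evalList ys)
      ≡⟨ factor (fromℕ x) (fromℕ y) q (evalList ys) ⟩
    fromℕ x * (fromℕ y + q * evalList ys) ∎
    where
    factor : ∀ a c Q Y → a * c + Q * (a * Y) ≡ a * (c + Q * Y)
    factor = solve 4 (λ a c Q Y → a :* c :+ Q :* (a :* Y) := a :* (c :+ Q :* Y)) refl

  evalList-mulL : ∀ xs ys → evalList (mulL xs ys) ≡ evalList xs * evalList ys
  evalList-mulL []       ys = sym (ℚₚ.*-zeroˡ (evalList ys))
  evalList-mulL (x ∷ xs) ys = begin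
    evalList (addL (scaleL x ys) (0 ∷ mulL xs ys))
      ≡⟨ evalList-addL (scaleL x ys) (0 ∷ mulL xs ys) ⟩
    evalList (scaleL x ys) + (0ℚ + q * evalList (mulL xs ys))
      ≡⟨ cong₂ (λ a c → a + (0ℚ + q * c)) (evalList-scaleL x ys) (evalList-mulL xs ys) ⟩
    fromℕ x * evalList ys + (0ℚ + q * (evalList xs * evalList ys))
      ≡⟨ factor (fromℕ x) q (evalList xs) (evalList ys) ⟩
    (fromℕ x + q * evalList xs) * evalList ys ∎
    where
    factor : ∀ a Q X Y → a * Y + (0ℚ + Q * (X * Y)) ≡ (a + Q * X) * Y
    factor = solve 4 (λ a Q X Y → a :* Y :+ (con 0ℚ :+ Q :* (X :* Y)) := (a :+ Q :* X) :* Y) refl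

  evalList-padding : ∀ m xs → evalList (replicate m 0 ++ xs) ≡ q^ m * evalList xs
  evalList-padding zero    xs = sym (ℚₚ.*-identityˡ (evalList xs))
  evalList-padding (suc m) xs = begin
    0ℚ + q * evalList (replicate m 0 ++ xs)  ≡⟨ cong (λ t → 0ℚ + q * t) (evalList-padding m xs) ⟩
    0ℚ + q * (q^ m * evalList xs)            ≡⟨ ℚₚ.+-identityˡ _ ⟩
    q * (q^ m * evalList xs)                 ≡⟨ sym (ℚₚ.*-assoc q (q^ m) (evalList xs)) ⟩
    q * q^ m * evalList xs                   ∎

  q^ℤ-*-q^∣-∣ : ∀ a m → m ℤ.≤ a → q^ℤ m * q^ ℤ.∣ a ℤ.- m ∣ ≡ q^ℤ a
  q^ℤ-*-q^∣-∣ a m m≤a = begin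
    q^ℤ m * q^ℤ (+ ℤ.∣ a ℤ.- m ∣)  ≡⟨ cong (λ t → q^ℤ m * q^ℤ t) (ℤₚ.0≤i⇒+∣i∣≡i (ℤₚ.i≤j⇒0≤j-i m≤a)) ⟩
    q^ℤ m * q^ℤ (a ℤ.- m)          ≡⟨ sym (q^ℤ-+ m (a ℤ.- m)) ⟩
    q^ℤ (m ℤ.+ (a ℤ.- m))          ≡⟨ cong q^ℤ_ (cancel m a) ⟩
    q^ℤ a                          ∎
    where
    cancel : ∀ m a → m ℤ.+ (a ℤ.- m) ≡ a
    cancel = solve-∀

  eval-+L : ∀ p p′ → eval (p +L p′) ≡ eval p + eval p′
  eval-+L (lp a xs) (lp a′ ys) = begin
    q^ℤ m * evalList (addL (replicate d 0 ++ xs) (replicate d′ 0 ++ ys))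
      ≡⟨ cong (q^ℤ m *_) (evalList-addL (replicate d 0 ++ xs) (replicate d′ 0 ++ ys)) ⟩
    q^ℤ m * (evalList (replicate d 0 ++ xs) + evalList (replicate d′ 0 ++ ys))
      ≡⟨ cong₂ (λ x y → q^ℤ m * (x + y)) (evalList-padding d xs) (evalList-padding d′ ys) ⟩
    q^ℤ m * (q^ d * evalList xs + q^ d′ * evalList ys)
      ≡⟨ distrib (q^ℤ m) (q^ d) (evalList xs) (q^ d′) (evalList ys) ⟩
    (q^ℤ m * q^ d) * evalList xs + (q^ℤ m * q^ d′) * evalList ys
      ≡⟨ cong₂ (λ x y → x * evalList xs + y * evalList ys)
               (q^ℤ-*-q^∣-∣ a m (ℤₚ.i⊓j≤i a a′)) (q^ℤ-*-q^∣-∣ a′ m (ℤₚ.i⊓j≤j a a′)) ⟩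
    q^ℤ a * evalList xs + q^ℤ a′ * evalList ys ∎
    where
    m = a ℤ.⊓ a′
    d = ℤ.∣ a ℤ.- m ∣
    d′ = ℤ.∣ a′ ℤ.- m ∣
    distrib : ∀ P A X B Y → P * (A * X + B * Y) ≡ (P * A) * X + (P * B) * Y
    distrib = solve 5 (λ P A X B Y → P :* (A :* X :+ B :* Y) := (P :* A) :* X :+ (P :* B) :* Y) refl

  eval-*L : ∀ p p′ → eval (p *L p′) ≡ eval p * eval p′
  eval-*L (lp a xs) (lp a′ ys) = begin
    q^ℤ (a ℤ.+ a′) * evalList (mulL xs ys)          ≡⟨ cong₂ _*_ (q^ℤ-+ a a′) (evalList-mulL xs ys) ⟩
    (q^ℤ a * q^ℤ a′) * (evalList xs * evalList ys)  ≡⟨ interchange (q^ℤ a) (q^ℤ a′) (evalList xs) (evalList ys) ⟩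
    (q^ℤ a * evalList xs) * (q^ℤ a′ * evalList ys)  ∎
    where
    interchange : ∀ a b c d → (a * b) * (c * d) ≡ (a * c) * (b * d)
    interchange = solve 4 (λ a b c d → (a :* b) :* (c :* d) := (a :* c) :* (b :* d)) refl

  evalList-single : ∀ x → evalList (x ∷ []) ≡ fromℕ x
  evalList-single x = trans (cong (_+_ (fromℕ x)) (ℚₚ.*-zeroʳ q)) (ℚₚ.+-identityʳ (fromℕ x))

  eval-mono : ∀ e → eval (mono e) ≡ q^ℤ e
  eval-mono e = trans (cong (q^ℤ e *_) (evalList-single 1)) (ℚₚ.*-identityʳ (q^ℤ e))

  eval-^L : ∀ p r → eval (p ^L r) ≡ eval p ^ℚ r
  eval-^L p zero    = eval-mono (+ 0)
  eval-^L p (suc r) = trans (eval-*L p (p ^L r)) (cong (eval p *_) (eval-^L p r))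

  eval-sumN : ∀ m f → eval (sumN m f) ≡ ∑ m (λ t → eval (f t))
  eval-sumN zero    f = refl
  eval-sumN (suc m) f = trans (eval-+L (sumN m f) (f m)) (cong (_+ eval (f m)) (eval-sumN m f))

  evalList-qbL : ∀ n k → evalList (qbL n k) ≡ qbinom n k
  evalList-qbL zero    zero    = evalList-single 1
  evalList-qbL zero    (suc k) = refl
  evalList-qbL (suc n) zero    = evalList-single 1
  evalList-qbL (suc n) (suc k) = begin
    evalList (addL (qbL n k) (replicate (suc k) 0 ++ qbL n (suc k)))
      ≡⟨ evalList-addL (qbL n k) (replicate (suc k) 0 ++ qbL n (suc k)) ⟩
    evalList (qbL n k) + evalList (replicate (suc k) 0 ++ qbL n (suc k))
      ≡⟨ cong (_+_ (evalList (qbL n k))) (evalList-padding (suc k) (qbL n (suc k))) ⟩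
    evalList (qbL n k) + q^ suc k * evalList (qbL n (suc k))
      ≡⟨ cong₂ (λ x y → x + q^ suc k * y) (evalList-qbL n k) (evalList-qbL n (suc k)) ⟩
    qbinom n k + q^ suc k * qbinom n (suc k) ∎

  eval-qbin : ∀ n k → eval (qbin n k) ≡ qbinom n k
  eval-qbin n k = trans (ℚₚ.*-identityˡ (evalList (qbL n k))) (evalList-qbL n k)

  eval-qbinZ : ∀ x y → eval (qbinZ x y) ≡ qbinomℤ x y
  eval-qbinZ (+ n)    (+ k)    = eval-qbin n k
  eval-qbinZ (+ n)    -[1+ _ ] = refl
  eval-qbinZ -[1+ _ ] _        = refl

  private
    lookupℤ : List ℕ → ℤ → ℕ
    lookupℤ xs (+ m)    = lookupD xs m
    lookupℤ xs -[1+ _ ] = 0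

    coeff-lp : ∀ a xs z → coeff (lp a xs) z ≡ lookupℤ xs (z ℤ.- a)
    coeff-lp a xs z with z ℤ.- a
    ... | + m      = refl
    ... | -[1+ m ] = refl

    lookupD-padding : ∀ d xs t → lookupD (replicate d 0 ++ xs) t ≡ lookupℤ xs (t ⊖ d)
    lookupD-padding zero    xs t       = cong (lookupℤ xs) (sym (ℤₚ.⊖-≥ {t} {0} z≤n))
    lookupD-padding (suc d) xs zero    = refl
    lookupD-padding (suc d) xs (suc t) =
      trans (lookupD-padding d xs t) (cong (lookupℤ xs) (sym (ℤₚ.[1+m]⊖[1+n]≡m⊖n t d)))

    evalList-∑ : ∀ ys N → length ys ≤ N → evalList ys ≡ ∑ N (λ t → fromℕ (lookupD ys t) * q^ t)
    evalList-∑ []       N       _         = sym (∑-zero N _ (λ t _ → ℚₚ.*-zeroˡ (q^ t)))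
    evalList-∑ (y ∷ ys) (suc N) (s≤s len≤N) = begin
      fromℕ y + q * evalList ys
        ≡⟨ cong (λ x → fromℕ y + q * x) (evalList-∑ ys N len≤N) ⟩
      fromℕ y + q * ∑ N (λ t → fromℕ (lookupD ys t) * q^ t)
        ≡⟨ cong (_+_ (fromℕ y)) (∑-distribˡ-* N _ q) ⟩
      fromℕ y + ∑ N (λ t → q * (fromℕ (lookupD ys t) * q^ t))
        ≡⟨ cong₂ _+_ (sym (ℚₚ.*-identityʳ (fromℕ y))) (∑-cong N (λ t _ → swap q (fromℕ (lookupD ys t)) (q^ t))) ⟩
      fromℕ y * 1ℚ + ∑ N (λ t → fromℕ (lookupD ys t) * q^ suc t)
        ≡⟨ sym (∑-suc-head N (λ t → fromℕ (lookupD (y ∷ ys) t) * q^ t)) ⟩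
      ∑ (suc N) (λ t → fromℕ (lookupD (y ∷ ys) t) * q^ t) ∎
      where
      swap : ∀ Q a x → Q * (a * x) ≡ a * (Q * x)
      swap = solve 3 (λ Q a x → Q :* (a :* x) := a :* (Q :* x)) refl

  window : LPoly → ℤ → ℕ → ℚ
  window p z₀ N = ∑ N (λ t → fromℕ (coeff p (z₀ ℤ.+ + t)) * q^ t)

  eval-window : ∀ a xs z₀ N → z₀ ℤ.≤ a → ℤ.∣ a ℤ.- z₀ ∣ ℕ.+ length xs ≤ N →
    eval (lp a xs) ≡ q^ℤ z₀ * window (lp a xs) z₀ N
  eval-window a xs z₀ N z₀≤a len≤N = begin
    q^ℤ a * evalList xs                      ≡⟨ cong (_* evalList xs) (sym (q^ℤ-*-q^∣-∣ a z₀ z₀≤a)) ⟩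
    (q^ℤ z₀ * q^ d) * evalList xs            ≡⟨ ℚₚ.*-assoc (q^ℤ z₀) (q^ d) (evalList xs) ⟩
    q^ℤ z₀ * (q^ d * evalList xs)            ≡⟨ cong (q^ℤ z₀ *_) (sym (evalList-padding d xs)) ⟩
    q^ℤ z₀ * evalList (replicate d 0 ++ xs)  ≡⟨ cong (q^ℤ z₀ *_) (evalList-∑ (replicate d 0 ++ xs) N padded≤N) ⟩
    q^ℤ z₀ * ∑ N (λ t → fromℕ (lookupD (replicate d 0 ++ xs) t) * q^ t)
      ≡⟨ cong (q^ℤ z₀ *_) (∑-cong N (λ t _ → cong (λ x → fromℕ x * q^ t) (padded-coeff t))) ⟩
    q^ℤ z₀ * window (lp a xs) z₀ N           ∎
    where
    d = ℤ.∣ a ℤ.- z₀ ∣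
    padded≤N : length (replicate d 0 ++ xs) ≤ N
    padded≤N = subst (_≤ N) (sym (trans (Listₚ.length-++ (replicate d 0))
                                        (cong (ℕ._+ length xs) (Listₚ.length-replicate d)))) len≤N
    reindex : ∀ z₀ t a → (z₀ ℤ.+ t) ℤ.- a ≡ t ℤ.- (a ℤ.- z₀)
    reindex = solve-∀
    padded-coeff : ∀ t → lookupD (replicate d 0 ++ xs) t ≡ coeff (lp a xs) (z₀ ℤ.+ + t)
    padded-coeff t = begin
      lookupD (replicate d 0 ++ xs) t  ≡⟨ lookupD-padding d xs t ⟩
      lookupℤ xs (t ⊖ d)               ≡⟨ cong (lookupℤ xs) (sym (ℤₚ.m-n≡m⊖n t d)) ⟩
      lookupℤ xs (+ t ℤ.- + d)         ≡⟨ cong (λ x → lookupℤ xs (+ t ℤ.- x)) (ℤₚ.0≤i⇒+∣i∣≡i (ℤₚ.i≤j⇒0≤j-i z₀≤a)) ⟩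
      lookupℤ xs (+ t ℤ.- (a ℤ.- z₀))  ≡⟨ cong (lookupℤ xs) (sym (reindex z₀ (+ t) a)) ⟩
      lookupℤ xs ((z₀ ℤ.+ + t) ℤ.- a)  ≡⟨ sym (coeff-lp a xs (z₀ ℤ.+ + t)) ⟩
      coeff (lp a xs) (z₀ ℤ.+ + t)     ∎

  eval-resp-≈ : ∀ p p′ → p ≈ p′ → eval p ≡ eval p′
  eval-resp-≈ (lp a xs) (lp a′ ys) p≈p′ = begin
    eval (lp a xs)                 ≡⟨ eval-window a xs z₀ N (ℤₚ.i⊓j≤i a a′) (ℕₚ.m≤m+n A A′) ⟩
    q^ℤ z₀ * window (lp a xs) z₀ N
      ≡⟨ cong (q^ℤ z₀ *_) (∑-cong N (λ t _ → cong (λ x → fromℕ x * q^ t) (p≈p′ (z₀ ℤ.+ + t)))) ⟩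
    q^ℤ z₀ * window (lp a′ ys) z₀ N ≡⟨ sym (eval-window a′ ys z₀ N (ℤₚ.i⊓j≤j a a′) (ℕₚ.m≤n+m A′ A)) ⟩
    eval (lp a′ ys)                ∎
    where
    z₀ = a ℤ.⊓ a′
    A = ℤ.∣ a ℤ.- z₀ ∣ ℕ.+ length xs
    A′ = ℤ.∣ a′ ℤ.- z₀ ∣ ℕ.+ length ys
    N = A ℕ.+ A′

  window-fromℕ : ∀ p z₀ N → window p z₀ N ≡ fromℕ (Digits.value base N (λ t → coeff p (z₀ ℤ.+ + t)))
  window-fromℕ p z₀ zero    = refl
  window-fromℕ p z₀ (suc N) = begin
    window p z₀ N + fromℕ (d N) * q^ N
      ≡⟨ cong₂ (λ x y → x + fromℕ (d N) * y) (window-fromℕ p z₀ N) (q^-fromℕ N) ⟩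
    fromℕ (Digits.value base N d) + fromℕ (d N) * fromℕ (base ℕ.^ N)
      ≡⟨ cong (_+_ (fromℕ (Digits.value base N d))) (sym (fromℕ-* (d N) (base ℕ.^ N))) ⟩
    fromℕ (Digits.value base N d) + fromℕ (d N ℕ.* base ℕ.^ N)
      ≡⟨ sym (fromℕ-+ (Digits.value base N d) (d N ℕ.* base ℕ.^ N)) ⟩
    fromℕ (Digits.value base (suc N) d) ∎
    where
    d = λ t → coeff p (z₀ ℤ.+ + t)

private
  lookupD≤sum : ∀ xs m → lookupD xs m ≤ sum xs
  lookupD≤sum []       m       = z≤n
  lookupD≤sum (x ∷ xs) zero    = ℕₚ.m≤m+n x (sum xs)
  lookupD≤sum (x ∷ xs) (suc m) = ℕₚ.≤-trans (lookupD≤sum xs m) (ℕₚ.m≤n+m (sum xs) x)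

  coeff≤sum : ∀ a xs z → coeff (lp a xs) z ≤ sum xs
  coeff≤sum a xs z with z ℤ.- a
  ... | + m      = lookupD≤sum xs m
  ... | -[1+ _ ] = z≤n

-- At q larger than the sum of all coefficients, the value is a base-q numeral.
eval-injective : ∀ p p′ → (∀ b → Evaluation.eval b p ≡ Evaluation.eval b p′) → p ≈ p′
eval-injective (lp a xs) (lp a′ ys) same-values z =
  trans (cong (coeff (lp a xs)) (sym z₀+D≡z))
        (trans same-digit (cong (coeff (lp a′ ys)) z₀+D≡z))
  where
  b = sum xs ℕ.+ sum ys
  open Rational
  open Evaluation b
  open Powers b using (base; q^ℤ_; q^ℤ≢0)
  z₀ = (a ℤ.⊓ a′) ℤ.⊓ z
  A = ℤ.∣ a ℤ.- z₀ ∣ ℕ.+ length xs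
  A′ = ℤ.∣ a′ ℤ.- z₀ ∣ ℕ.+ length ys
  D = ℤ.∣ z ℤ.- z₀ ∣
  N = A ℕ.+ A′ ℕ.+ suc D
  z₀≤a : z₀ ℤ.≤ a
  z₀≤a = ℤₚ.≤-trans (ℤₚ.i⊓j≤i (a ℤ.⊓ a′) z) (ℤₚ.i⊓j≤i a a′)
  z₀≤a′ : z₀ ℤ.≤ a′
  z₀≤a′ = ℤₚ.≤-trans (ℤₚ.i⊓j≤i (a ℤ.⊓ a′) z) (ℤₚ.i⊓j≤j a a′)
  same-window : window (lp a xs) z₀ N ≡ window (lp a′ ys) z₀ N
  same-window = *-cancelˡ-≢0 (q^ℤ≢0 z₀) (begin
    q^ℤ z₀ * window (lp a xs) z₀ N
      ≡⟨ sym (eval-window a xs z₀ N z₀≤a (ℕₚ.≤-trans (ℕₚ.m≤m+n A A′) (ℕₚ.m≤m+n (A ℕ.+ A′) (suc D)))) ⟩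
    eval (lp a xs)  ≡⟨ same-values b ⟩
    eval (lp a′ ys)
      ≡⟨ eval-window a′ ys z₀ N z₀≤a′ (ℕₚ.≤-trans (ℕₚ.m≤n+m A′ A) (ℕₚ.m≤m+n (A ℕ.+ A′) (suc D))) ⟩
    q^ℤ z₀ * window (lp a′ ys) z₀ N ∎)
  digit< : ∀ a xs → sum xs ≤ b → ∀ t → coeff (lp a xs) (z₀ ℤ.+ + t) < base
  digit< a xs sum≤b t = s≤s (ℕₚ.≤-trans (ℕₚ.≤-trans (coeff≤sum a xs (z₀ ℤ.+ + t)) sum≤b) (ℕₚ.n≤1+n b))
  same-digit : coeff (lp a xs) (z₀ ℤ.+ + D) ≡ coeff (lp a′ ys) (z₀ ℤ.+ + D)
  same-digit = Digits.digits-unique base N _ _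
    (digit< a xs (ℕₚ.m≤m+n (sum xs) (sum ys))) (digit< a′ ys (ℕₚ.m≤n+m (sum ys) (sum xs)))
    (fromℕ-injective (trans (sym (window-fromℕ (lp a xs) z₀ N)) (trans same-window (window-fromℕ (lp a′ ys) z₀ N))))
    D (ℕₚ.m≤n+m (suc D) (A ℕ.+ A′))
  z₀+D≡z : z₀ ℤ.+ + D ≡ z
  z₀+D≡z = trans (cong (ℤ._+_ z₀) (ℤₚ.0≤i⇒+∣i∣≡i (ℤₚ.i≤j⇒0≤j-i (ℤₚ.i⊓j≤j (a ℤ.⊓ a′) z)))) (cancel z₀ z)
    where
    cancel : ∀ z₀ z → z₀ ℤ.+ (z ℤ.- z₀) ≡ z
    cancel = solve-∀

step : ℕ → (ℕ → LPoly) → ℕ → ℕ → LPoly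
step k F j i = mono ((+ j ℤ.- + i) ℤ.* (+ (j ℕ.+ k))) *L qbin (k ℕ.+ i) i
  *L qbinZ (+ k) (+ i ℤ.- + j) *L qbin (k ℕ.+ j) j *L F i

-- P k r i = P^(r)_(k,i); the values for r = 0, and for r = 1 and i ≠ k, are never used.
P : ℕ → ℕ → ℕ → LPoly
P k zero          i = 1L
P k (suc zero)    i = 1L
P k (suc (suc r)) m = sumFromTo k (suc r ℕ.* k) (step k (P k (suc r)) (m ∸ k))

P-suc-suc : ∀ k r j → P k (suc (suc r)) (k ℕ.+ j) ≡ sumFromTo k (suc r ℕ.* k) (step k (P k (suc r)) j)
P-suc-suc k r j = cong (λ j → sumFromTo k (suc r ℕ.* k) (step k (P k (suc r)) j)) (ℕₚ.m+n∸m≡n k j)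

suc[k+x]∸k : ∀ k x → suc (k ℕ.+ x) ∸ k ≡ suc x
suc[k+x]∸k k x = trans (ℕₚ.+-∸-assoc 1 (ℕₚ.m≤m+n k x)) (cong suc (ℕₚ.m+n∸m≡n k x))

expansion : ℕ → ℕ → ℕ → (ℕ → LPoly) → LPoly
expansion k r n F = sumFromTo k (n ⊓ (r ℕ.* k)) (λ i →
  mono (+ ((r ℕ.* k ∸ i) ℕ.* n)) *L qbin n i *L qbin (n ℕ.+ i) i *L F i)

module Expansion (b : ℕ) where
  open Rational
  open Powers b
  open Binomials b
  open Linearisation b
  open Evaluation b

  eval-step : ∀ k F j i → eval (step k F j i) ≡ c k i j * eval (F i)
  eval-step k F j i = begin
    eval (m *L A *L Z *L A′ *L F i)
      ≡⟨ eval-*L (m *L A *L Z *L A′) (F i) ⟩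
    eval (m *L A *L Z *L A′) * eval (F i)
      ≡⟨ cong (_* eval (F i)) (trans (eval-*L (m *L A *L Z) A′) (cong (_* eval A′)
           (trans (eval-*L (m *L A) Z) (cong (_* eval Z) (eval-*L m A))))) ⟩
    eval m * eval A * eval Z * eval A′ * eval (F i)
      ≡⟨ cong₂ (λ x y → x * eval A * y * eval A′ * eval (F i)) (eval-mono e) (eval-qbinZ (+ k) (+ i ℤ.- + j)) ⟩
    q^ℤ e * eval A * qbinomℤ (+ k) (+ i ℤ.- + j) * eval A′ * eval (F i)
      ≡⟨ cong₂ (λ x y → q^ℤ e * x * qbinomℤ (+ k) (+ i ℤ.- + j) * y * eval (F i))
               (eval-qbin (k ℕ.+ i) i) (eval-qbin (k ℕ.+ j) j) ⟩
    c k i j * eval (F i) ∎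
    where
    e = (+ j ℤ.- + i) ℤ.* (+ (j ℕ.+ k))
    m = mono e
    A = qbin (k ℕ.+ i) i
    Z = qbinZ (+ k) (+ i ℤ.- + j)
    A′ = qbin (k ℕ.+ j) j

  eval-sumFromTo : ∀ a c f → eval (sumFromTo a c f) ≡ ∑ (suc c ∸ a) (λ t → eval (f (a ℕ.+ t)))
  eval-sumFromTo a c f = eval-sumN (suc c ∸ a) (λ t → f (a ℕ.+ t))

  eval-P-suc-suc : ∀ k r j → eval (P k (suc (suc r)) (k ℕ.+ j))
    ≡ ∑ (suc (r ℕ.* k)) (λ t → c k (k ℕ.+ t) j * eval (P k (suc r) (k ℕ.+ t)))
  eval-P-suc-suc k r j = begin
    eval (P k (suc (suc r)) (k ℕ.+ j))
      ≡⟨ cong eval (P-suc-suc k r j) ⟩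
    eval (sumFromTo k (suc r ℕ.* k) (step k (P k (suc r)) j))
      ≡⟨ eval-sumFromTo k (suc r ℕ.* k) (step k (P k (suc r)) j) ⟩
    ∑ (suc (k ℕ.+ r ℕ.* k) ∸ k) (λ t → eval (step k (P k (suc r)) j (k ℕ.+ t)))
      ≡⟨ cong (λ N → ∑ N (λ t → eval (step k (P k (suc r)) j (k ℕ.+ t)))) (suc[k+x]∸k k (r ℕ.* k)) ⟩
    ∑ (suc (r ℕ.* k)) (λ t → eval (step k (P k (suc r)) j (k ℕ.+ t)))
      ≡⟨ ∑-cong (suc (r ℕ.* k)) (λ t _ → eval-step k (P k (suc r)) j (k ℕ.+ t)) ⟩
    ∑ (suc (r ℕ.* k)) (λ t → c k (k ℕ.+ t) j * eval (P k (suc r) (k ℕ.+ t))) ∎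

  q^-*-q^ℤ : ∀ R i j n → i ≤ R → j ≤ R →
    q^ ((R ∸ i) ℕ.* n) * q^ℤ ((+ i ℤ.- + j) ℤ.* + n) ≡ q^ ((R ∸ j) ℕ.* n)
  q^-*-q^ℤ R i j n i≤R j≤R = begin
    q^ℤ (+ ((R ∸ i) ℕ.* n)) * q^ℤ ((+ i ℤ.- + j) ℤ.* + n)
      ≡⟨ sym (q^ℤ-+ (+ ((R ∸ i) ℕ.* n)) ((+ i ℤ.- + j) ℤ.* + n)) ⟩
    q^ℤ (+ ((R ∸ i) ℕ.* n) ℤ.+ (+ i ℤ.- + j) ℤ.* + n)
      ≡⟨ cong (λ x → q^ℤ (x ℤ.+ (+ i ℤ.- + j) ℤ.* + n)) (trans (ℤₚ.pos-* (R ∸ i) n) (cong (ℤ._* + n) (pos-∸ i≤R))) ⟩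
    q^ℤ ((+ R ℤ.- + i) ℤ.* + n ℤ.+ (+ i ℤ.- + j) ℤ.* + n)
      ≡⟨ cong q^ℤ_ (telescope (+ R) (+ i) (+ j) (+ n)) ⟩
    q^ℤ ((+ R ℤ.- + j) ℤ.* + n)
      ≡⟨ sym (cong q^ℤ_ (trans (ℤₚ.pos-* (R ∸ j) n) (cong (ℤ._* + n) (pos-∸ j≤R)))) ⟩
    q^ℤ (+ ((R ∸ j) ℕ.* n)) ∎
    where
    pos-∸ : ∀ {a c} → c ≤ a → + (a ∸ c) ≡ + a ℤ.- + c
    pos-∸ {a} {c} c≤a = sym (trans (ℤₚ.m-n≡m⊖n a c) (ℤₚ.⊖-≥ c≤a))
    telescope : ∀ R i j n → (R ℤ.- i) ℤ.* n ℤ.+ (i ℤ.- j) ℤ.* n ≡ (R ℤ.- j) ℤ.* n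
    telescope = solve-∀

  -- The theorem at the point q = b + 2, with the sum not yet truncated at n.
  B-power-expansion : ∀ k r n → B n k ^ℚ suc r
    ≡ ∑ (suc (r ℕ.* k)) (λ t → q^ ((suc r ℕ.* k ∸ (k ℕ.+ t)) ℕ.* n) * B n (k ℕ.+ t) * eval (P k (suc r) (k ℕ.+ t)))
  B-power-expansion k zero n = begin
    B n k * 1ℚ                                  ≡⟨ ℚₚ.*-identityʳ (B n k) ⟩
    B n k                                       ≡⟨ sym (ℚₚ.*-identityˡ (B n k)) ⟩
    q^ 0 * B n k                                ≡⟨ sym (ℚₚ.*-identityʳ (q^ 0 * B n k)) ⟩
    q^ 0 * B n k * 1ℚ                           ≡⟨ cong₂ (λ e m → q^ (e ℕ.* n) * B n m * 1ℚ)
                                                         (sym (ℕₚ.n∸n≡0 (k ℕ.+ 0))) (sym (ℕₚ.+-identityʳ k)) ⟩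
    q^ ((k ℕ.+ 0 ∸ (k ℕ.+ 0)) ℕ.* n) * B n (k ℕ.+ 0) * 1ℚ
      ≡⟨ cong (q^ ((k ℕ.+ 0 ∸ (k ℕ.+ 0)) ℕ.* n) * B n (k ℕ.+ 0) *_) (sym (eval-mono (+ 0))) ⟩
    q^ ((k ℕ.+ 0 ∸ (k ℕ.+ 0)) ℕ.* n) * B n (k ℕ.+ 0) * eval (P k 1 (k ℕ.+ 0))
      ≡⟨ sym (ℚₚ.+-identityˡ _) ⟩
    ∑ 1 (λ t → q^ ((1 ℕ.* k ∸ (k ℕ.+ t)) ℕ.* n) * B n (k ℕ.+ t) * eval (P k 1 (k ℕ.+ t))) ∎
  B-power-expansion k (suc r) n = begin
    B n k * B n k ^ℚ suc r                          ≡⟨ cong (B n k *_) (B-power-expansion k r n) ⟩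
    B n k * ∑ N f                                   ≡⟨ ∑-distribˡ-* N f (B n k) ⟩
    ∑ N (λ t → B n k * f t)                         ≡⟨ ∑-cong N (λ t t<N → linearise t t<N) ⟩
    ∑ N (λ t → ∑ M (λ j → w t * T n k (k ℕ.+ t) j)) ≡⟨ ∑-swap N M (λ t j → w t * T n k (k ℕ.+ t) j) ⟩
    ∑ M (λ j → ∑ N (λ t → w t * T n k (k ℕ.+ t) j)) ≡⟨ ∑-cong M (λ j j<M → collect j j<M) ⟩
    ∑ M (λ j → q^ ((suc (suc r) ℕ.* k ∸ (k ℕ.+ j)) ℕ.* n) * B n (k ℕ.+ j) * eval (P k (suc (suc r)) (k ℕ.+ j))) ∎
    where
    R = suc r ℕ.* k
    N = suc (r ℕ.* k)
    M = suc R
    w : ℕ → ℚ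
    w t = q^ ((R ∸ (k ℕ.+ t)) ℕ.* n) * eval (P k (suc r) (k ℕ.+ t))
    f : ℕ → ℚ
    f t = q^ ((R ∸ (k ℕ.+ t)) ℕ.* n) * B n (k ℕ.+ t) * eval (P k (suc r) (k ℕ.+ t))
    k+t≤R : ∀ t → t < N → k ℕ.+ t ≤ R
    k+t≤R t (s≤s t≤rk) = ℕₚ.+-monoʳ-≤ k t≤rk
    linearise : ∀ t → t < N → B n k * f t ≡ ∑ M (λ j → w t * T n k (k ℕ.+ t) j)
    linearise t t<N = begin
      B n k * f t                                ≡⟨ regroup₁ (B n k) (q^ ((R ∸ (k ℕ.+ t)) ℕ.* n)) (B n (k ℕ.+ t)) _ ⟩
      w t * (B n k * B n (k ℕ.+ t))              ≡⟨ cong (w t *_) (B*B-expansion n k (k ℕ.+ t) M (s≤s (k+t≤R t t<N))) ⟩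
      w t * ∑ M (T n k (k ℕ.+ t))                ≡⟨ ∑-distribˡ-* M (T n k (k ℕ.+ t)) (w t) ⟩
      ∑ M (λ j → w t * T n k (k ℕ.+ t) j)        ∎
      where
      regroup₁ : ∀ B a X E → B * (a * X * E) ≡ a * E * (B * X)
      regroup₁ = solve 4 (λ B a X E → B :* (a :* X :* E) := a :* E :* (B :* X)) refl
    collect : ∀ j → j < M → ∑ N (λ t → w t * T n k (k ℕ.+ t) j)
      ≡ q^ ((suc (suc r) ℕ.* k ∸ (k ℕ.+ j)) ℕ.* n) * B n (k ℕ.+ j) * eval (P k (suc (suc r)) (k ℕ.+ j))
    collect j (s≤s j≤R) = begin
      ∑ N (λ t → w t * T n k (k ℕ.+ t) j)
        ≡⟨ ∑-cong N (λ t t<N → trans (regroup₂ (q^ ((R ∸ (k ℕ.+ t)) ℕ.* n)) (eval (P k (suc r) (k ℕ.+ t))) _ (c k (k ℕ.+ t) j) (B n (k ℕ.+ j)))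
                                      (cong (λ x → x * B n (k ℕ.+ j) * (c k (k ℕ.+ t) j * eval (P k (suc r) (k ℕ.+ t))))
                                            (q^-*-q^ℤ R (k ℕ.+ t) j n (k+t≤R t t<N) j≤R))) ⟩
      ∑ N (λ t → q^ ((R ∸ j) ℕ.* n) * B n (k ℕ.+ j) * (c k (k ℕ.+ t) j * eval (P k (suc r) (k ℕ.+ t))))
        ≡⟨ sym (∑-distribˡ-* N (λ t → c k (k ℕ.+ t) j * eval (P k (suc r) (k ℕ.+ t))) (q^ ((R ∸ j) ℕ.* n) * B n (k ℕ.+ j))) ⟩
      q^ ((R ∸ j) ℕ.* n) * B n (k ℕ.+ j) * ∑ N (λ t → c k (k ℕ.+ t) j * eval (P k (suc r) (k ℕ.+ t)))
        ≡⟨ cong₂ (λ e x → q^ (e ℕ.* n) * B n (k ℕ.+ j) * x) (sym (ℕₚ.[m+n]∸[m+o]≡n∸o k R j)) (sym (eval-P-suc-suc k r j)) ⟩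
      q^ ((k ℕ.+ R ∸ (k ℕ.+ j)) ℕ.* n) * B n (k ℕ.+ j) * eval (P k (suc (suc r)) (k ℕ.+ j)) ∎
      where
      regroup₂ : ∀ a E P c B → a * E * (P * c * B) ≡ (a * P) * B * (c * E)
      regroup₂ = solve 5 (λ a E P c B → a :* E :* (P :* c :* B) := (a :* P) :* B :* (c :* E)) refl

  eval-power : ∀ n k r → eval ((qbin n k *L qbin (n ℕ.+ k) k) ^L r) ≡ B n k ^ℚ r
  eval-power n k r = trans (eval-^L (qbin n k *L qbin (n ℕ.+ k) k) r)
    (cong (_^ℚ r) (trans (eval-*L (qbin n k) (qbin (n ℕ.+ k) k)) (cong₂ _*_ (eval-qbin n k) (eval-qbin (n ℕ.+ k) k))))

  eval-expansion : ∀ k r n F → eval (expansion k r n F)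
    ≡ ∑ (suc (n ⊓ (r ℕ.* k)) ∸ k) (λ t → q^ ((r ℕ.* k ∸ (k ℕ.+ t)) ℕ.* n) * B n (k ℕ.+ t) * eval (F (k ℕ.+ t)))
  eval-expansion k r n F = trans (eval-sumFromTo k (n ⊓ (r ℕ.* k)) summand)
                                 (∑-cong (suc (n ⊓ (r ℕ.* k)) ∸ k) (λ t _ → term (k ℕ.+ t)))
    where
    summand : ℕ → LPoly
    summand i = mono (+ ((r ℕ.* k ∸ i) ℕ.* n)) *L qbin n i *L qbin (n ℕ.+ i) i *L F i
    term : ∀ i → eval (summand i)
               ≡ q^ ((r ℕ.* k ∸ i) ℕ.* n) * B n i * eval (F i)
    term i = begin
      eval (mono e *L qbin n i *L qbin (n ℕ.+ i) i *L F i)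
        ≡⟨ eval-*L (mono e *L qbin n i *L qbin (n ℕ.+ i) i) (F i) ⟩
      eval (mono e *L qbin n i *L qbin (n ℕ.+ i) i) * eval (F i)
        ≡⟨ cong (_* eval (F i)) (trans (eval-*L (mono e *L qbin n i) (qbin (n ℕ.+ i) i))
             (cong₂ _*_ (trans (eval-*L (mono e) (qbin n i)) (cong₂ _*_ (eval-mono e) (eval-qbin n i)))
                        (eval-qbin (n ℕ.+ i) i))) ⟩
      q^ℤ e * qbinom n i * qbinom (n ℕ.+ i) i * eval (F i)
        ≡⟨ cong (_* eval (F i)) (ℚₚ.*-assoc (q^ℤ e) (qbinom n i) (qbinom (n ℕ.+ i) i)) ⟩
      q^ℤ e * B n i * eval (F i) ∎
      where
      e = + ((r ℕ.* k ∸ i) ℕ.* n)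

  expansion-holds-at : ∀ k r n → k ≤ n →
    eval ((qbin n k *L qbin (n ℕ.+ k) k) ^L suc r) ≡ eval (expansion k (suc r) n (P k (suc r)))
  expansion-holds-at k r n k≤n = begin
    eval ((qbin n k *L qbin (n ℕ.+ k) k) ^L suc r) ≡⟨ eval-power n k (suc r) ⟩
    B n k ^ℚ suc r                                 ≡⟨ B-power-expansion k r n ⟩
    ∑ (suc (r ℕ.* k)) H                            ≡⟨ ∑-zero-tail N (suc (r ℕ.* k)) H N≤ vanish ⟩
    ∑ N H                                          ≡⟨ sym (eval-expansion k (suc r) n (P k (suc r))) ⟩
    eval (expansion k (suc r) n (P k (suc r)))     ∎
    where
    R = suc r ℕ.* k
    H : ℕ → ℚ
    H t = q^ ((R ∸ (k ℕ.+ t)) ℕ.* n) * B n (k ℕ.+ t) * eval (P k (suc r) (k ℕ.+ t))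
    N = suc (n ⊓ R) ∸ k
    N≤ : N ≤ suc (r ℕ.* k)
    N≤ = subst (N ≤_) (suc[k+x]∸k k (r ℕ.* k)) (ℕₚ.∸-monoˡ-≤ k (s≤s (ℕₚ.m⊓n≤n n R)))
    beyond : ∀ t → N ≤ t → suc (n ⊓ R) ≤ k ℕ.+ t
    beyond t N≤t = subst (_≤ k ℕ.+ t)
      (ℕₚ.m+[n∸m]≡n (ℕₚ.≤-trans (ℕₚ.⊓-glb k≤n (ℕₚ.m≤m+n k (r ℕ.* k))) (ℕₚ.n≤1+n _))) (ℕₚ.+-monoʳ-≤ k N≤t)
    n<k+t : ∀ t → N ≤ t → t < suc (r ℕ.* k) → n < k ℕ.+ t
    n<k+t t N≤t (s≤s t≤rk) with ℕₚ.⊓-sel n R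
    ... | inj₁ n⊓R≡n = subst (λ x → suc x ≤ k ℕ.+ t) n⊓R≡n (beyond t N≤t)
    ... | inj₂ n⊓R≡R = ⊥-elim (ℕₚ.<-irrefl refl
      (ℕₚ.<-≤-trans (subst (λ x → suc x ≤ k ℕ.+ t) n⊓R≡R (beyond t N≤t)) (ℕₚ.+-monoʳ-≤ k t≤rk)))
    vanish : ∀ t → N ≤ t → t < suc (r ℕ.* k) → H t ≡ 0ℚ
    vanish t N≤t t<N′ = begin
      q^ ((R ∸ (k ℕ.+ t)) ℕ.* n) * (qbinom n (k ℕ.+ t) * qbinom (n ℕ.+ (k ℕ.+ t)) (k ℕ.+ t)) * eval (P k (suc r) (k ℕ.+ t))
        ≡⟨ cong (λ x → q^ ((R ∸ (k ℕ.+ t)) ℕ.* n) * (x * qbinom (n ℕ.+ (k ℕ.+ t)) (k ℕ.+ t)) * eval (P k (suc r) (k ℕ.+ t)))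
                (qbinom-> n (k ℕ.+ t) (n<k+t t N≤t t<N′)) ⟩
      q^ ((R ∸ (k ℕ.+ t)) ℕ.* n) * (0ℚ * qbinom (n ℕ.+ (k ℕ.+ t)) (k ℕ.+ t)) * eval (P k (suc r) (k ℕ.+ t))
        ≡⟨ zero-factor (q^ ((R ∸ (k ℕ.+ t)) ℕ.* n)) (qbinom (n ℕ.+ (k ℕ.+ t)) (k ℕ.+ t)) (eval (P k (suc r) (k ℕ.+ t))) ⟩
      0ℚ ∎
      where
      zero-factor : ∀ x y e → x * (0ℚ * y) * e ≡ 0ℚ
      zero-factor = solve 3 (λ x y e → x :* (con 0ℚ :* y) :* e := con 0ℚ) refl

  -- The values at n = k, k + 1, …, k + rk form a lower triangular system for the values of the
  -- coefficients, with nonzero diagonal q^((R-n)n) [n,n][2n,n].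
  coefficients-unique-at : ∀ k r (F : ℕ → LPoly) →
    (∀ n → k ≤ n → eval ((qbin n k *L qbin (n ℕ.+ k) k) ^L suc r) ≡ eval (expansion k (suc r) n F)) →
    ∀ u → u ≤ r ℕ.* k → eval (F (k ℕ.+ u)) ≡ eval (P k (suc r) (k ℕ.+ u))
  coefficients-unique-at k r F F-expands = lower-triangular-unique (r ℕ.* k) X
    (λ t → eval (F (k ℕ.+ t))) (λ t → eval (P k (suc r) (k ℕ.+ t))) diagonal≢0 rows
    where
    R = suc r ℕ.* k
    X : ℕ → ℕ → ℚ
    X w t = q^ ((R ∸ (k ℕ.+ t)) ℕ.* (k ℕ.+ w)) * B (k ℕ.+ w) (k ℕ.+ t)
    row : ∀ w → w ≤ r ℕ.* k → (G : ℕ → LPoly) →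
      eval (expansion k (suc r) (k ℕ.+ w) G) ≡ ∑ (suc w) (λ t → X w t * eval (G (k ℕ.+ t)))
    row w w≤rk G = trans (eval-expansion k (suc r) (k ℕ.+ w) G)
      (cong (λ N → ∑ N (λ t → X w t * eval (G (k ℕ.+ t))))
            (trans (cong (λ x → suc x ∸ k) (ℕₚ.m≤n⇒m⊓n≡m (ℕₚ.+-monoʳ-≤ k w≤rk))) (suc[k+x]∸k k w)))
    rows : ∀ w → w ≤ r ℕ.* k → ∑ (suc w) (λ t → X w t * eval (F (k ℕ.+ t)))
                              ≡ ∑ (suc w) (λ t → X w t * eval (P k (suc r) (k ℕ.+ t)))
    rows w w≤rk = begin
      ∑ (suc w) (λ t → X w t * eval (F (k ℕ.+ t)))           ≡⟨ sym (row w w≤rk F) ⟩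
      eval (expansion k (suc r) (k ℕ.+ w) F)                  ≡⟨ sym (F-expands (k ℕ.+ w) (ℕₚ.m≤m+n k w)) ⟩
      eval ((qbin (k ℕ.+ w) k *L qbin (k ℕ.+ w ℕ.+ k) k) ^L suc r)
                                                              ≡⟨ expansion-holds-at k r (k ℕ.+ w) (ℕₚ.m≤m+n k w) ⟩
      eval (expansion k (suc r) (k ℕ.+ w) (P k (suc r)))      ≡⟨ row w w≤rk (P k (suc r)) ⟩
      ∑ (suc w) (λ t → X w t * eval (P k (suc r) (k ℕ.+ t))) ∎
    diagonal≢0 : ∀ w → w ≤ r ℕ.* k → X w w ≢ 0ℚ
    diagonal≢0 w _ = *-≢0 (q^≢0 ((R ∸ (k ℕ.+ w)) ℕ.* (k ℕ.+ w))) (*-≢0 (qbinom≢0 (k ℕ.+ w) (k ℕ.+ w) ℕₚ.≤-refl)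
                                         (qbinom≢0 (k ℕ.+ w ℕ.+ (k ℕ.+ w)) (k ℕ.+ w) (ℕₚ.m≤n+m (k ℕ.+ w) (k ℕ.+ w))))

expansion-holds : ∀ k r → 1 ≤ r → ∀ n → k ≤ n → (qbin n k *L qbin (n ℕ.+ k) k) ^L r ≈ expansion k r n (P k r)
expansion-holds k (suc r) _ n k≤n = eval-injective _ _ (λ b → Expansion.expansion-holds-at b k r n k≤n)

expansion-unique : ∀ k r → 1 ≤ r → (F : ℕ → LPoly) →
  (∀ n → k ≤ n → (qbin n k *L qbin (n ℕ.+ k) k) ^L r ≈ expansion k r n F) →
  ∀ i → k ≤ i → i ≤ r ℕ.* k → F i ≈ P k r i
expansion-unique k (suc r) _ F F-expands i k≤i i≤R = eval-injective (F i) (P k (suc r) i) (λ b →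
  subst (λ x → Evaluation.eval b (F x) ≡ Evaluation.eval b (P k (suc r) x)) (ℕₚ.m+[n∸m]≡n k≤i)
    (Expansion.coefficients-unique-at b k r F (λ n k≤n → Evaluation.eval-resp-≈ b _ _ (F-expands n k≤n)) (i ∸ k)
      (subst (i ∸ k ≤_) (ℕₚ.m+n∸m≡n k (r ℕ.* k)) (ℕₚ.∸-monoˡ-≤ k i≤R))))

P-recursion : ∀ k r j → 1 ≤ r → P k (suc r) (k ℕ.+ j) ≈ sumFromTo k (r ℕ.* k) (step k (P k r) j)
P-recursion k (suc r) j _ z = cong (λ L → coeff L z) (P-suc-suc k r j)

open import Data.Nat using (_+_; _*_)
open import Data.Integer using () renaming (_-_ to _-ℤ_; _*_ to _*ℤ_)
open import Data.Product using (Σ; _×_; _,_)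

lemma1p2 : Σ (ℕ → ℕ → ℕ → LPoly) λ P →
    ((k r : ℕ) → 1 ≤ r →
      ((n : ℕ) → k ≤ n →
        (qbin n k *L qbin (n + k) k) ^L r
          ≈ sumFromTo k (n ⊓ (r * k)) (λ i →
              mono (+ ((r * k ∸ i) * n)) *L qbin n i *L qbin (n + i) i *L P k r i))
      × ((Q : ℕ → LPoly) →
          ((n : ℕ) → k ≤ n →
            (qbin n k *L qbin (n + k) k) ^L r
              ≈ sumFromTo k (n ⊓ (r * k)) (λ i →
                  mono (+ ((r * k ∸ i) * n)) *L qbin n i *L qbin (n + i) i *L Q i)) →
          (i : ℕ) → k ≤ i → i ≤ r * k → Q i ≈ P k r i))
  × ((k : ℕ) → P k 1 k ≈ 1L)
  × ((k r j : ℕ) → 1 ≤ r → j ≤ r * k →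
      P k (suc r) (k + j)
        ≈ sumFromTo k (r * k) (λ i →
            mono ((+ j -ℤ + i) *ℤ (+ (j + k))) *L qbin (k + i) i
              *L qbinZ (+ k) (+ i -ℤ + j) *L qbin (k + j) j *L P k r i))
lemma1p2 =
  P , (λ k r 1≤r → expansion-holds k r 1≤r , expansion-unique k r 1≤r)
    , (λ k z → refl)
    , (λ k r j 1≤r _ → P-recursion k r j 1≤r)
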